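{- For every modal formula $A$ and every natural number $s>\mathrm{cx}(A)$, the following are equivalent: (1) $A$ is nontrifling, i.e. $\mathsf{GL}_\omega\nvdash\Box\Box A\to\Box A$; (2) $\mathsf{GL}_\omega\nvdash\Box A$ and $\mathsf{GL}_\omega\nvdash\neg\Box A$; (3) $\mathsf{GLS}\nvdash\Box A$ and $\mathsf{GLS}\nvdash\neg\Box A$; (4) $\mathsf{GL}+\{\neg F_s\}\nvdash\Box A$ and $\mathsf{GL}+\{\neg F_s\}\nvdash\neg\Box A$; (5) $\mathsf{GL}\nvdash A$ and $\mathsf{GL}\nvdash\bigwedge\mathrm{Rf}(\Box A)\to\neg\Box A$.
   Context: Modal formulas are built from propositional variables, $\top,\bot$, $\land,\lor,\neg,\to,\leftrightarrow$ and the unary operator $\Box$. $\mathrm{Sub}(A)$ is the set of subformulas of $A$; $\mathrm{cx}(A)$ is the number of subformulas of $A$ of the form $\Box C$. $\Box^0A=A$, $\Box^{n+1}A=\Box\Box^nA$, $\Diamond^nA=\neg\Box^n\neg A$. $\mathsf{GL}$ (Gödel–Löb logic) has as axioms all propositional tautologies, $\Box(p\to q)\to(\Box p\to\Box q)$ and $\Box(\Box p\to p)\to\Box p$, and rules modus ponens, necessitation and uniform substitution. For a set $\Gamma$ of modal formulas, $\mathsf{GL}+\Gamma$ is the logic whose axioms are all theorems of $\mathsf{GL}$ and the elements of $\Gamma$, with rules modus ponens and uniform substitution only. $\mathsf{GL}_\omega:=\mathsf{GL}+\{\Diamond^n\top\mid n\in\omega\}$ and $\mathsf{GLS}:=\mathsf{GL}+\{\Box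 p\to p\}$. $F_s$ is the formula $\Box^{s+1}\bot\to\Box^s\bot$. $\mathrm{Rf}(A)=\{\Box B\to B\mid \Box B\in\mathrm{Sub}(A)\}$. -}

module Defs where

open import Data.Nat using (ℕ; zero; suc) renaming (_≡ᵇ_ to _≡ℕᵇ_)
open import Data.Bool using (Bool; true; false; _∧_; _∨_; not; if_then_else_)
open import Data.List using (List; []; _∷_; _++_; length; deduplicateᵇ; foldr; map)
open import Data.Product using (∃)
open import Relation.Binary.PropositionalEquality using (_≡_)

infixr 6 _⋏_
infixr 5 _⋎_
infixr 4 _⇒_ _⟺_

data Fm : Set where
  var : ℕ → Fm
  ⊤' ⊥' : Fm
  _⋏_ _⋎_ _⇒_ _⟺_ : Fm → Fm → Fm
  ¬' □ : Fm → Fm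

_==_ : Fm → Fm → Bool
var m == var n = m ≡ℕᵇ n
⊤' == ⊤' = true
⊥' == ⊥' = true
(a ⋏ b) == (c ⋏ d) = (a == c) ∧ (b == d)
(a ⋎ b) == (c ⋎ d) = (a == c) ∧ (b == d)
(a ⇒ b) == (c ⇒ d) = (a == c) ∧ (b == d)
(a ⟺ b) == (c ⟺ d) = (a == c) ∧ (b == d)
¬' a == ¬' c = a == c
□ a == □ c = a == c
_ == _ = false

sub : Fm → List Fm
sub (var n) = var n ∷ []
sub ⊤' = ⊤' ∷ []
sub ⊥' = ⊥' ∷ []
sub (a ⋏ b) = (a ⋏ b) ∷ sub a ++ sub b
sub (a ⋎ b) = (a ⋎ b) ∷ sub a ++ sub b
sub (a ⇒ b) = (a ⇒ b) ∷ sub a ++ sub b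
sub (a ⟺ b) = (a ⟺ b) ∷ sub a ++ sub b
sub (¬' a) = ¬' a ∷ sub a
sub (□ a) = □ a ∷ sub a

boxedArgs : Fm → List Fm
boxedArgs (var n) = []
boxedArgs ⊤' = []
boxedArgs ⊥' = []
boxedArgs (a ⋏ b) = boxedArgs a ++ boxedArgs b
boxedArgs (a ⋎ b) = boxedArgs a ++ boxedArgs b
boxedArgs (a ⇒ b) = boxedArgs a ++ boxedArgs b
boxedArgs (a ⟺ b) = boxedArgs a ++ boxedArgs b
boxedArgs (¬' a) = boxedArgs a
boxedArgs (□ a) = a ∷ boxedArgs a

distinctBoxedArgs : Fm → List Fm
distinctBoxedArgs A = deduplicateᵇ _==_ (boxedArgs A)

cx : Fm → ℕ
cx A = length (distinctBoxedArgs A)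

⋀ : List Fm → Fm
⋀ = foldr _⋏_ ⊤'

⋀Rf : Fm → Fm
⋀Rf A = ⋀ (map (λ B → □ B ⇒ B) (distinctBoxedArgs A))

□^ : ℕ → Fm → Fm
□^ zero A = A
□^ (suc n) A = □ (□^ n A)

◇^ : ℕ → Fm → Fm
◇^ n A = ¬' (□^ n (¬' A))

F : ℕ → Fm
F s = □^ (suc s) ⊥' ⇒ □^ s ⊥'

subst : (ℕ → Fm) → Fm → Fm
subst σ (var n) = σ n
subst σ ⊤' = ⊤'
subst σ ⊥' = ⊥'
subst σ (a ⋏ b) = subst σ a ⋏ subst σ b
subst σ (a ⋎ b) = subst σ a ⋎ subst σ b
subst σ (a ⇒ b) = subst σ a ⇒ subst σ b
subst σ (a ⟺ b) = subst σ a ⟺ subst σ b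
subst σ (¬' a) = ¬' (subst σ a)
subst σ (□ a) = □ (subst σ a)

-- Propositional tautologies: true under every Boolean valuation of the
-- variables and every Boolean valuation of the boxed formulas (treated as atoms).
eval : (ℕ → Bool) → (Fm → Bool) → Fm → Bool
eval v b (var n) = v n
eval v b ⊤' = true
eval v b ⊥' = false
eval v b (x ⋏ y) = eval v b x ∧ eval v b y
eval v b (x ⋎ y) = eval v b x ∨ eval v b y
eval v b (x ⇒ y) = not (eval v b x) ∨ eval v b y
eval v b (x ⟺ y) = if eval v b x then eval v b y else not (eval v b y)
eval v b (¬' x) = not (eval v b x)
eval v b (□ x) = b x

Tautology : Fm → Set
Tautology A = ∀ (v : ℕ → Bool) (b : Fm → Bool) → eval v b A ≡ true

p q : Fm
p = var 0
q = var 1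

data GL⊢_ : Fm → Set where
  taut : ∀ {A} → Tautology A → GL⊢ A
  axK : GL⊢ (□ (p ⇒ q) ⇒ (□ p ⇒ □ q))
  axL : GL⊢ (□ (□ p ⇒ p) ⇒ □ p)
  mp : ∀ {A B} → GL⊢ (A ⇒ B) → GL⊢ A → GL⊢ B
  nec : ∀ {A} → GL⊢ A → GL⊢ □ A
  usub : ∀ {A} (σ : ℕ → Fm) → GL⊢ A → GL⊢ subst σ A

-- GL + Γ : axioms = theorems of GL and elements of Γ; rules MP and US only
data _⊢_ (Γ : Fm → Set) : Fm → Set where
  gl : ∀ {A} → GL⊢ A → Γ ⊢ A
  hyp : ∀ {A} → Γ A → Γ ⊢ A
  mp : ∀ {A B} → Γ ⊢ (A ⇒ B) → Γ ⊢ A → Γ ⊢ B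
  usub : ∀ {A} (σ : ℕ → Fm) → Γ ⊢ A → Γ ⊢ subst σ A

GLω : Fm → Set
GLω B = ∃ λ n → B ≡ ◇^ n ⊤'

GLS : Fm → Set
GLS B = B ≡ (□ p ⇒ p)

GL¬F : ℕ → Fm → Set
GL¬F s B = B ≡ ¬' (F s)

module Submission where

-- Everything is proved semantically, over Kripke models with finitely many successors per world, a transitive
-- accessibility relation and a rank witnessing converse well-foundedness.  GL is sound for these models and
-- complete for them (constructively, up to double negation): the canonical model on the consistent truth
-- assignments to Sub(X) has rank bounded by the number of distinct boxed subformulas of X.  In such models
-- ◇ⁿ⊤ holds exactly at the worlds of depth ≥ n and ¬F_s exactly at the worlds of depth s.
--
-- (5) ⇒ (3), (4), (1).  Appending to a world w an ascending chain of copies of w produces worlds of every depth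
-- beyond that of w; far along the chain every instance of □p → p holds, and if Rf(□A) holds at w the copies
-- agree with w on □A.  So a refutation of A, or of Rf(□A) → ¬□A, becomes a model of GLS, resp. GL + ¬F_s,
-- refuting □A, resp. ¬□A.  For GLω, a refutation of □A → A and a world satisfying Rf(□A) ∧ □A are placed
-- under a common new root together with a deep copy, giving ◇ⁿ⊤ ∧ □□A ∧ ¬□A.
--
-- (2), (4) ⇒ (5).  Below a world of depth ≥ s > cx(A) satisfying □A there is a chain of s steps along which the
-- number of true □C, □C ∈ Sub(A), never decreases; it cannot increase at every step, and where it does not,
-- Rf(□A) ∧ □A holds.

open import Defs
open import Data.Bool using (Bool; true; false; _∧_; _∨_; not; if_then_else_; T)
import Data.Bool as Bool
open import Data.Bool.ListAction using (all; any; and)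
open import Data.Bool.Properties
  using (∧-conicalˡ; ∧-conicalʳ; ∧-identityʳ; ∧-zeroʳ; ∨-zeroʳ; ¬-not; not-¬; T-≡; T?)
open import Data.Empty using (⊥; ⊥-elim)
open import Data.List using (List; []; _∷_; _++_; map; foldr; length; downFrom; filterᵇ; deduplicateᵇ)
open import Data.List.Membership.Propositional using (_∈_)
open import Data.List.Membership.Propositional.Properties
  using (∈-map⁺; ∈-map⁻; ∈-++⁺ˡ; ∈-++⁺ʳ; ∈-++⁻; ∈-filter⁺; ∈-filter⁻; ∈-deduplicate⁻; ∈-downFrom⁺; ∈-downFrom⁻)
open import Data.List.Properties using (map-∘)
open import Data.List.Relation.Binary.Subset.Propositional using (_⊆_)
open import Data.List.Relation.Unary.All using (All; []; _∷_)
open import Data.List.Relation.Unary.Any using (here; there)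
open import Data.Nat using (ℕ; zero; suc; _+_; _∸_; _⊔_; _<_; _≤_; z≤n; s≤s; _<ᵇ_)
open import Data.Nat.Properties
  using (_≟_; ≤-refl; ≤-trans; ≤-total; ≤-pred; <-trans; <-≤-trans; <⇒≢; <⇒≱; ≤∧≢⇒<; n≤1+n; m≤n⇒m≤1+n;
         m≤m⊔n; m≤n⊔m; m≤m+n; +-monoʳ-<; +-monoʳ-≤; +-suc; +-identityʳ; suc-injective; ∸-monoʳ-<; m∸n≤m;
         m<n⇒0<n∸m; m+[n∸m]≡n; ≡ᵇ⇒≡; ≡⇒≡ᵇ; <ᵇ⇒<; module ≤-Reasoning)
open import Data.Product using (Σ; _×_; _,_; proj₁; proj₂)
open import Data.Sum using (_⊎_; inj₁; inj₂; [_,_]′)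
open import Data.Unit using (⊤; tt)
open import Function using (_∘_; _∘₂_; id)
open import Function.Bundles using (Equivalence; _⇔_; mk⇔)
open import Relation.Binary.PropositionalEquality
  using (_≡_; refl; sym; trans; cong; cong₂; module ≡-Reasoning) renaming (subst to ≡-subst)
open import Relation.Nullary using (¬_; ¬?; Dec; yes; no)
open import Relation.Nullary.Decidable using (¬¬-excluded-middle; decidable-stable)

∧-true : ∀ {a b} → a ≡ true → b ≡ true → a ∧ b ≡ true
∧-true refl refl = refl

not∨-intro : ∀ {a b} → (a ≡ true → b ≡ true) → not a ∨ b ≡ true
not∨-intro {true} f = f refl
not∨-intro {false} f = refl

not∨-elim : ∀ {a b} → not a ∨ b ≡ true → a ≡ true → b ≡ true
not∨-elim {true} e refl = e

not∨-false⁻ : ∀ {a b} → not a ∨ b ≡ false → a ≡ true × b ≡ false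
not∨-false⁻ {true} {false} e = refl , refl

not∨-false⁺ : ∀ {a b} → a ≡ true → b ≡ false → not a ∨ b ≡ false
not∨-false⁺ refl refl = refl

not-true : ∀ {a} → not a ≡ true → a ≡ false
not-true {false} e = refl

not-false : ∀ {a} → not a ≡ false → a ≡ true
not-false {true} e = refl

≡true-ext : ∀ {a b} → (a ≡ true → b ≡ true) → (b ≡ true → a ≡ true) → a ≡ b
≡true-ext {true} f g = sym (f refl)
≡true-ext {false} {true} f g = g refl
≡true-ext {false} {false} f g = refl

T-∧ˡ : ∀ {a b} → T (a ∧ b) → T a
T-∧ˡ {true} _ = _

T-∧ʳ : ∀ {a b} → T (a ∧ b) → T b
T-∧ʳ {true} t = t

T-∧-intro : ∀ {a b} → T a → T b → T (a ∧ b)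
T-∧-intro {true} _ t = t

module _ {A : Set} where

  all-true⁻ : ∀ {p : A → Bool} xs → all p xs ≡ true → ∀ {x} → x ∈ xs → p x ≡ true
  all-true⁻ {p} (y ∷ xs) e (here refl) = ∧-conicalˡ (p y) _ e
  all-true⁻ {p} (y ∷ xs) e (there m) = all-true⁻ xs (∧-conicalʳ (p y) _ e) m

  all-true⁺ : ∀ {p : A → Bool} xs → (∀ {x} → x ∈ xs → p x ≡ true) → all p xs ≡ true
  all-true⁺ [] h = refl
  all-true⁺ (y ∷ xs) h = ∧-true (h (here refl)) (all-true⁺ xs (h ∘ there))

  all-false⁻ : ∀ {p : A → Bool} xs → all p xs ≡ false → Σ A λ x → x ∈ xs × p x ≡ false
  all-false⁻ {p} (y ∷ xs) e with p y in py
  ... | false = y , here refl , py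
  ... | true = let x , m , px = all-false⁻ xs e in x , there m , px

  all-false⁺ : ∀ {p : A → Bool} xs {x} → x ∈ xs → p x ≡ false → all p xs ≡ false
  all-false⁺ xs m px = ¬-not λ e → not-¬ (all-true⁻ xs e m) px

  all-cong : ∀ {p q : A → Bool} xs → (∀ {x} → x ∈ xs → p x ≡ q x) → all p xs ≡ all q xs
  all-cong [] h = refl
  all-cong (y ∷ xs) h = cong₂ _∧_ (h (here refl)) (all-cong xs (h ∘ there))

  all-++ : ∀ (p : A → Bool) xs ys → all p (xs ++ ys) ≡ all p xs ∧ all p ys
  all-++ p [] ys = refl
  all-++ p (x ∷ xs) ys with p x
  ... | true = all-++ p xs ys
  ... | false = refl

  all-const-true : ∀ (xs : List A) → all (λ _ → true) xs ≡ true
  all-const-true [] = refl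
  all-const-true (x ∷ xs) = all-const-true xs

  any-true⁻ : ∀ {p : A → Bool} xs → any p xs ≡ true → Σ A λ x → x ∈ xs × p x ≡ true
  any-true⁻ {p} (y ∷ xs) e with p y in py
  ... | true = y , here refl , py
  ... | false = let x , m , px = any-true⁻ xs e in x , there m , px

  any-true⁺ : ∀ {p : A → Bool} xs {x} → x ∈ xs → p x ≡ true → any p xs ≡ true
  any-true⁺ {p} (y ∷ xs) (here refl) e rewrite e = refl
  any-true⁺ {p} (y ∷ xs) (there m) e with p y
  ... | true = refl
  ... | false = any-true⁺ xs m e

  ∈-filterᵇ⁺ : ∀ {p : A → Bool} {xs x} → x ∈ xs → p x ≡ true → x ∈ filterᵇ p xs
  ∈-filterᵇ⁺ {p} m e = ∈-filter⁺ (T? ∘ p) m (≡-subst T (sym e) tt)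

  ∈-filterᵇ⁻ : ∀ {p : A → Bool} {xs x} → x ∈ filterᵇ p xs → x ∈ xs × p x ≡ true
  ∈-filterᵇ⁻ {p} m = let m' , t = ∈-filter⁻ (T? ∘ p) m in m' , Equivalence.to T-≡ t

module _ {A B : Set} where

  all-map : ∀ (p : B → Bool) (f : A → B) xs → all p (map f xs) ≡ all (p ∘ f) xs
  all-map p f xs = cong and (sym (map-∘ xs))

module _ {A : Set} where

  countᵇ : (A → Bool) → List A → ℕ
  countᵇ p [] = 0
  countᵇ p (x ∷ xs) = (if p x then 1 else 0) + countᵇ p xs

  countᵇ≤length : ∀ p xs → countᵇ p xs ≤ length xs
  countᵇ≤length p [] = z≤n
  countᵇ≤length p (x ∷ xs) with p x
  ... | true = s≤s (countᵇ≤length p xs)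
  ... | false = m≤n⇒m≤1+n (countᵇ≤length p xs)

  module _ (p q : A → Bool) where

    countᵇ-mono : ∀ xs → (∀ {x} → x ∈ xs → p x ≡ true → q x ≡ true) → countᵇ p xs ≤ countᵇ q xs
    countᵇ-mono [] h = z≤n
    countᵇ-mono (x ∷ xs) h with p x in px | q x in qx
    ... | true | true = s≤s (countᵇ-mono xs (h ∘ there))
    ... | true | false = ⊥-elim (not-¬ (h (here refl) px) qx)
    ... | false | true = m≤n⇒m≤1+n (countᵇ-mono xs (h ∘ there))
    ... | false | false = countᵇ-mono xs (h ∘ there)

    countᵇ-strict : ∀ xs → (∀ {x} → x ∈ xs → p x ≡ true → q x ≡ true) →
      ∀ {y} → y ∈ xs → p y ≡ false → q y ≡ true → countᵇ p xs < countᵇ q xs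
    countᵇ-strict (x ∷ xs) h (here refl) py qy rewrite py | qy = s≤s (countᵇ-mono xs (h ∘ there))
    countᵇ-strict (x ∷ xs) h (there m) py qy with p x in px | q x in qx
    ... | true | true = s≤s (countᵇ-strict xs (h ∘ there) m py qy)
    ... | true | false = ⊥-elim (not-¬ (h (here refl) px) qx)
    ... | false | true = m≤n⇒m≤1+n (countᵇ-strict xs (h ∘ there) m py qy)
    ... | false | false = countᵇ-strict xs (h ∘ there) m py qy

    countᵇ-≡ : ∀ xs → (∀ {x} → x ∈ xs → p x ≡ true → q x ≡ true) → countᵇ p xs ≡ countᵇ q xs →
      ∀ {y} → y ∈ xs → q y ≡ true → p y ≡ true
    countᵇ-≡ xs h eq {y} m qy with p y in py
    ... | true = refl
    ... | false = ⊥-elim (<⇒≢ (countᵇ-strict xs h m py qy) eq)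

  module _ {P : A → Set} where

    select : ∀ xs → All (λ x → Dec (P x)) xs → List A
    select [] [] = []
    select (x ∷ xs) (yes _ ∷ ds) = x ∷ select xs ds
    select (x ∷ xs) (no _ ∷ ds) = select xs ds

    ∈-select⁻ : ∀ xs ds {y} → y ∈ select xs ds → y ∈ xs × P y
    ∈-select⁻ (x ∷ xs) (yes px ∷ ds) (here refl) = here refl , px
    ∈-select⁻ (x ∷ xs) (yes _ ∷ ds) (there m) = let a , b = ∈-select⁻ xs ds m in there a , b
    ∈-select⁻ (x ∷ xs) (no _ ∷ ds) m = let a , b = ∈-select⁻ xs ds m in there a , b

    ∈-select⁺ : ∀ xs ds {y} → y ∈ xs → P y → y ∈ select xs ds
    ∈-select⁺ (x ∷ xs) (yes _ ∷ ds) (here refl) py = here refl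
    ∈-select⁺ (x ∷ xs) (no ¬px ∷ ds) (here refl) py = ⊥-elim (¬px py)
    ∈-select⁺ (x ∷ xs) (yes _ ∷ ds) (there m) py = there (∈-select⁺ xs ds m py)
    ∈-select⁺ (x ∷ xs) (no _ ∷ ds) (there m) py = ∈-select⁺ xs ds m py

    ¬¬-decide-all : ∀ xs → ¬ ¬ All (λ x → Dec (P x)) xs
    ¬¬-decide-all [] k = k []
    ¬¬-decide-all (x ∷ xs) k = ¬¬-decide-all xs λ ds → ¬¬-excluded-middle λ d → k (d ∷ ds)

bools : ℕ → List (List Bool)
bools zero = [] ∷ []
bools (suc n) = map (true ∷_) (bools n) ++ map (false ∷_) (bools n)

∈-bools⁺ : ∀ {cs} → cs ∈ bools (length cs)
∈-bools⁺ {[]} = here refl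
∈-bools⁺ {true ∷ cs} = ∈-++⁺ˡ (∈-map⁺ (true ∷_) ∈-bools⁺)
∈-bools⁺ {false ∷ cs} = ∈-++⁺ʳ _ (∈-map⁺ (false ∷_) ∈-bools⁺)

∈-bools⁻ : ∀ n {cs} → cs ∈ bools n → length cs ≡ n
∈-bools⁻ zero (here refl) = refl
∈-bools⁻ (suc n) m with ∈-++⁻ (map (true ∷_) (bools n)) m
... | inj₁ m₁ = let _ , m' , eq = ∈-map⁻ (true ∷_) m₁ in trans (cong length eq) (cong suc (∈-bools⁻ n m'))
... | inj₂ m₂ = let _ , m' , eq = ∈-map⁻ (false ∷_) m₂ in trans (cong length eq) (cong suc (∈-bools⁻ n m'))

==-sound : ∀ a b → T (a == b) → a ≡ b
==-sound (var m) (var n) e = cong var (≡ᵇ⇒≡ m n e)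
==-sound ⊤' ⊤' _ = refl
==-sound ⊥' ⊥' _ = refl
==-sound (a ⋏ b) (c ⋏ d) e = cong₂ _⋏_ (==-sound a c (T-∧ˡ e)) (==-sound b d (T-∧ʳ e))
==-sound (a ⋎ b) (c ⋎ d) e = cong₂ _⋎_ (==-sound a c (T-∧ˡ e)) (==-sound b d (T-∧ʳ e))
==-sound (a ⇒ b) (c ⇒ d) e = cong₂ _⇒_ (==-sound a c (T-∧ˡ e)) (==-sound b d (T-∧ʳ e))
==-sound (a ⟺ b) (c ⟺ d) e = cong₂ _⟺_ (==-sound a c (T-∧ˡ e)) (==-sound b d (T-∧ʳ e))
==-sound (¬' a) (¬' c) e = cong ¬' (==-sound a c e)
==-sound (□ a) (□ c) e = cong □ (==-sound a c e)

==-refl : ∀ a → T (a == a)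
==-refl (var n) = ≡⇒≡ᵇ n n refl
==-refl ⊤' = _
==-refl ⊥' = _
==-refl (a ⋏ b) = T-∧-intro (==-refl a) (==-refl b)
==-refl (a ⋎ b) = T-∧-intro (==-refl a) (==-refl b)
==-refl (a ⇒ b) = T-∧-intro (==-refl a) (==-refl b)
==-refl (a ⟺ b) = T-∧-intro (==-refl a) (==-refl b)
==-refl (¬' a) = ==-refl a
==-refl (□ a) = ==-refl a

subst-∘ : ∀ σ τ X → subst σ (subst τ X) ≡ subst (subst σ ∘ τ) X
subst-∘ σ τ (var n) = refl
subst-∘ σ τ ⊤' = refl
subst-∘ σ τ ⊥' = refl
subst-∘ σ τ (x ⋏ y) = cong₂ _⋏_ (subst-∘ σ τ x) (subst-∘ σ τ y)
subst-∘ σ τ (x ⋎ y) = cong₂ _⋎_ (subst-∘ σ τ x) (subst-∘ σ τ y)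
subst-∘ σ τ (x ⇒ y) = cong₂ _⇒_ (subst-∘ σ τ x) (subst-∘ σ τ y)
subst-∘ σ τ (x ⟺ y) = cong₂ _⟺_ (subst-∘ σ τ x) (subst-∘ σ τ y)
subst-∘ σ τ (¬' x) = cong ¬' (subst-∘ σ τ x)
subst-∘ σ τ (□ x) = cong □ (subst-∘ σ τ x)

subst-var : ∀ X → subst var X ≡ X
subst-var (var n) = refl
subst-var ⊤' = refl
subst-var ⊥' = refl
subst-var (x ⋏ y) = cong₂ _⋏_ (subst-var x) (subst-var y)
subst-var (x ⋎ y) = cong₂ _⋎_ (subst-var x) (subst-var y)
subst-var (x ⇒ y) = cong₂ _⇒_ (subst-var x) (subst-var y)
subst-var (x ⟺ y) = cong₂ _⟺_ (subst-var x) (subst-var y)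
subst-var (¬' x) = cong ¬' (subst-var x)
subst-var (□ x) = cong □ (subst-var x)

subst-□^ : ∀ σ n X → subst σ (□^ n X) ≡ □^ n (subst σ X)
subst-□^ σ zero X = refl
subst-□^ σ (suc n) X = cong □ (subst-□^ σ n X)

sub-refl : ∀ X → X ∈ sub X
sub-refl (var n) = here refl
sub-refl ⊤' = here refl
sub-refl ⊥' = here refl
sub-refl (a ⋏ b) = here refl
sub-refl (a ⋎ b) = here refl
sub-refl (a ⇒ b) = here refl
sub-refl (a ⟺ b) = here refl
sub-refl (¬' a) = here refl
sub-refl (□ a) = here refl

mutual
  sub-trans : ∀ X {Y} → Y ∈ sub X → sub Y ⊆ sub X
  sub-trans (var n) (here refl) = id
  sub-trans ⊤' (here refl) = id
  sub-trans ⊥' (here refl) = id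
  sub-trans (a ⋏ b) (here refl) = id
  sub-trans (a ⋎ b) (here refl) = id
  sub-trans (a ⇒ b) (here refl) = id
  sub-trans (a ⟺ b) (here refl) = id
  sub-trans (¬' a) (here refl) = id
  sub-trans (□ a) (here refl) = id
  sub-trans (a ⋏ b) (there m) = there ∘ sub-trans-++ a b m
  sub-trans (a ⋎ b) (there m) = there ∘ sub-trans-++ a b m
  sub-trans (a ⇒ b) (there m) = there ∘ sub-trans-++ a b m
  sub-trans (a ⟺ b) (there m) = there ∘ sub-trans-++ a b m
  sub-trans (¬' a) (there m) = there ∘ sub-trans a m
  sub-trans (□ a) (there m) = there ∘ sub-trans a m

  sub-trans-++ : ∀ a b {Y} → Y ∈ sub a ++ sub b → sub Y ⊆ sub a ++ sub b
  sub-trans-++ a b m with ∈-++⁻ (sub a) m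
  ... | inj₁ ma = ∈-++⁺ˡ ∘ sub-trans a ma
  ... | inj₂ mb = ∈-++⁺ʳ (sub a) ∘ sub-trans b mb

□∈sub⇒boxedArg : ∀ X {C} → □ C ∈ sub X → C ∈ boxedArgs X
□∈sub⇒boxedArg (var n) (here ())
□∈sub⇒boxedArg ⊤' (here ())
□∈sub⇒boxedArg ⊥' (here ())
□∈sub⇒boxedArg (a ⋏ b) (there m) =
  [ ∈-++⁺ˡ ∘ □∈sub⇒boxedArg a , ∈-++⁺ʳ _ ∘ □∈sub⇒boxedArg b ]′ (∈-++⁻ (sub a) m)
□∈sub⇒boxedArg (a ⋎ b) (there m) =
  [ ∈-++⁺ˡ ∘ □∈sub⇒boxedArg a , ∈-++⁺ʳ _ ∘ □∈sub⇒boxedArg b ]′ (∈-++⁻ (sub a) m)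
□∈sub⇒boxedArg (a ⇒ b) (there m) =
  [ ∈-++⁺ˡ ∘ □∈sub⇒boxedArg a , ∈-++⁺ʳ _ ∘ □∈sub⇒boxedArg b ]′ (∈-++⁻ (sub a) m)
□∈sub⇒boxedArg (a ⟺ b) (there m) =
  [ ∈-++⁺ˡ ∘ □∈sub⇒boxedArg a , ∈-++⁺ʳ _ ∘ □∈sub⇒boxedArg b ]′ (∈-++⁻ (sub a) m)
□∈sub⇒boxedArg (¬' a) (there m) = □∈sub⇒boxedArg a m
□∈sub⇒boxedArg (□ a) (here refl) = here refl
□∈sub⇒boxedArg (□ a) (there m) = there (□∈sub⇒boxedArg a m)

boxedArg⇒□∈sub : ∀ X {C} → C ∈ boxedArgs X → □ C ∈ sub X
boxedArg⇒□∈sub (a ⋏ b) m =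
  there ([ ∈-++⁺ˡ ∘ boxedArg⇒□∈sub a , ∈-++⁺ʳ _ ∘ boxedArg⇒□∈sub b ]′ (∈-++⁻ (boxedArgs a) m))
boxedArg⇒□∈sub (a ⋎ b) m =
  there ([ ∈-++⁺ˡ ∘ boxedArg⇒□∈sub a , ∈-++⁺ʳ _ ∘ boxedArg⇒□∈sub b ]′ (∈-++⁻ (boxedArgs a) m))
boxedArg⇒□∈sub (a ⇒ b) m =
  there ([ ∈-++⁺ˡ ∘ boxedArg⇒□∈sub a , ∈-++⁺ʳ _ ∘ boxedArg⇒□∈sub b ]′ (∈-++⁻ (boxedArgs a) m))
boxedArg⇒□∈sub (a ⟺ b) m =
  there ([ ∈-++⁺ˡ ∘ boxedArg⇒□∈sub a , ∈-++⁺ʳ _ ∘ boxedArg⇒□∈sub b ]′ (∈-++⁻ (boxedArgs a) m))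
boxedArg⇒□∈sub (¬' a) m = there (boxedArg⇒□∈sub a m)
boxedArg⇒□∈sub (□ a) (here refl) = here refl
boxedArg⇒□∈sub (□ a) (there m) = there (boxedArg⇒□∈sub a m)

boxedArg⇒∈sub : ∀ X {C} → C ∈ boxedArgs X → C ∈ sub X
boxedArg⇒∈sub X {C} m = sub-trans X (boxedArg⇒□∈sub X m) (there (sub-refl C))

boxedArgs-trans : ∀ X {C} → C ∈ boxedArgs X → boxedArgs C ⊆ boxedArgs X
boxedArgs-trans X m m' = □∈sub⇒boxedArg X (sub-trans X (boxedArg⇒∈sub X m) (boxedArg⇒□∈sub _ m'))

∈-dedup⁻ : ∀ xs {x} → x ∈ deduplicateᵇ _==_ xs → x ∈ xs
∈-dedup⁻ = ∈-deduplicate⁻ (T? ∘₂ _==_)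

∈-dedup⁺ : ∀ xs {x} → x ∈ xs → x ∈ deduplicateᵇ _==_ xs
∈-dedup⁺ (y ∷ ys) (here refl) = here refl
∈-dedup⁺ (y ∷ ys) {x} (there m) with y == x in eq
... | true = here (sym (==-sound y x (Equivalence.from T-≡ eq)))
... | false = there (∈-filter⁺ (¬? ∘ T? ∘ (y ==_)) (∈-dedup⁺ ys m) (≡-subst T eq))

boxedArgs-⋀Rf : ∀ Ls {S} → Ls ⊆ S → (∀ {B} → B ∈ S → boxedArgs B ⊆ S) →
  boxedArgs (⋀ (map (λ B → □ B ⇒ B) Ls)) ⊆ S
boxedArgs-⋀Rf (B ∷ Ls) Ls⊆S closed m with ∈-++⁻ (boxedArgs (□ B ⇒ B)) m
... | inj₁ (here refl) = Ls⊆S (here refl)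
... | inj₁ (there m') = [ closed (Ls⊆S (here refl)) , closed (Ls⊆S (here refl)) ]′ (∈-++⁻ (boxedArgs B) m')
... | inj₂ m' = boxedArgs-⋀Rf Ls (Ls⊆S ∘ there) closed m'

boxedArgs-Rf⇒¬□ : ∀ A → boxedArgs (⋀Rf (□ A) ⇒ ¬' (□ A)) ⊆ boxedArgs (□ A)
boxedArgs-Rf⇒¬□ A =
  [ boxedArgs-⋀Rf (distinctBoxedArgs (□ A)) (∈-dedup⁻ _) (boxedArgs-trans (□ A)) , id ]′
  ∘ ∈-++⁻ (boxedArgs (⋀Rf (□ A)))

□-args⊆ : ∀ A → boxedArgs (□ A) ⊆ A ∷ distinctBoxedArgs A
□-args⊆ A (here refl) = here refl
□-args⊆ A (there m) = there (∈-dedup⁺ _ m)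

□-args⊇ : ∀ A → A ∷ distinctBoxedArgs A ⊆ boxedArgs (□ A)
□-args⊇ A (here refl) = here refl
□-args⊇ A (there m) = there (∈-dedup⁻ _ m)

-- Propositional tautologies by truth tables

r : Fm
r = var 2

nth : List Fm → ℕ → Fm
nth [] k = ⊤'
nth (X ∷ Xs) zero = X
nth (X ∷ Xs) (suc k) = nth Xs k

propositionalIn : ℕ → Fm → Bool
propositionalIn n (var k) = k <ᵇ n
propositionalIn n ⊤' = true
propositionalIn n ⊥' = true
propositionalIn n (x ⋏ y) = propositionalIn n x ∧ propositionalIn n y
propositionalIn n (x ⋎ y) = propositionalIn n x ∧ propositionalIn n y
propositionalIn n (x ⇒ y) = propositionalIn n x ∧ propositionalIn n y
propositionalIn n (x ⟺ y) = propositionalIn n x ∧ propositionalIn n y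
propositionalIn n (¬' x) = propositionalIn n x
propositionalIn n (□ x) = false

_!ᵇ_ : List Bool → ℕ → Bool
[] !ᵇ k = false
(c ∷ cs) !ᵇ zero = c
(c ∷ cs) !ᵇ suc k = cs !ᵇ k

prefix : (ℕ → Bool) → ℕ → List Bool
prefix v zero = []
prefix v (suc n) = v 0 ∷ prefix (v ∘ suc) n

length-prefix : ∀ v n → length (prefix v n) ≡ n
length-prefix v zero = refl
length-prefix v (suc n) = cong suc (length-prefix (v ∘ suc) n)

prefix-!ᵇ : ∀ v {n k} → k < n → prefix v n !ᵇ k ≡ v k
prefix-!ᵇ v {suc n} {zero} _ = refl
prefix-!ᵇ v {suc n} {suc k} (s≤s k<n) = prefix-!ᵇ (v ∘ suc) k<n

isTautologyᵇ : ℕ → Fm → Bool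
isTautologyᵇ n S = propositionalIn n S ∧ all (λ cs → eval (cs !ᵇ_) (λ _ → false) S) (bools n)

eval-local : ∀ n S {v v' b b'} → T (propositionalIn n S) → (∀ {k} → k < n → v k ≡ v' k) →
  eval v b S ≡ eval v' b' S
eval-local n (var k) t agree = agree (<ᵇ⇒< k n t)
eval-local n ⊤' t agree = refl
eval-local n ⊥' t agree = refl
eval-local n (x ⋏ y) t agree = cong₂ _∧_ (eval-local n x (T-∧ˡ t) agree) (eval-local n y (T-∧ʳ t) agree)
eval-local n (x ⋎ y) t agree = cong₂ _∨_ (eval-local n x (T-∧ˡ t) agree) (eval-local n y (T-∧ʳ t) agree)
eval-local n (x ⇒ y) t agree =
  cong₂ (λ a c → not a ∨ c) (eval-local n x (T-∧ˡ t) agree) (eval-local n y (T-∧ʳ t) agree)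
eval-local n (x ⟺ y) t agree =
  cong₂ (λ a c → if a then c else not c) (eval-local n x (T-∧ˡ t) agree) (eval-local n y (T-∧ʳ t) agree)
eval-local n (¬' x) t agree = cong not (eval-local n x t agree)

isTautologyᵇ-sound : ∀ n S → T (isTautologyᵇ n S) → Tautology S
isTautologyᵇ-sound n S t v b = trans (eval-local n S (T-∧ˡ t) (sym ∘ prefix-!ᵇ v))
  (all-true⁻ (bools n) (Equivalence.to T-≡ (T-∧ʳ t))
             (≡-subst (λ k → prefix v n ∈ bools k) (length-prefix v n) ∈-bools⁺))

tautology : ∀ S Xs → {T (isTautologyᵇ (length Xs) S)} → GL⊢ subst (nth Xs) S
tautology S Xs {t} = usub (nth Xs) (taut {S} (isTautologyᵇ-sound (length Xs) S t))

module _ (f : Fm → Bool) (f-⊤ : f ⊤' ≡ true) (f-⋏ : ∀ {X Y} → f (X ⋏ Y) ≡ f X ∧ f Y) where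

  ⋀-true⁻ : ∀ Γ → f (⋀ Γ) ≡ true → ∀ {X} → X ∈ Γ → f X ≡ true
  ⋀-true⁻ (Y ∷ Γ) e (here refl) = ∧-conicalˡ (f Y) _ (trans (sym f-⋏) e)
  ⋀-true⁻ (Y ∷ Γ) e (there m) = ⋀-true⁻ Γ (∧-conicalʳ (f Y) _ (trans (sym f-⋏) e)) m

  ⋀-true⁺ : ∀ Γ → (∀ {X} → X ∈ Γ → f X ≡ true) → f (⋀ Γ) ≡ true
  ⋀-true⁺ [] h = f-⊤
  ⋀-true⁺ (Y ∷ Γ) h = trans f-⋏ (∧-true (h (here refl)) (⋀-true⁺ Γ (h ∘ there)))

mp₂ : ∀ {X Y Z} → GL⊢ (X ⇒ Y ⇒ Z) → GL⊢ X → GL⊢ Y → GL⊢ Z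
mp₂ d a b = mp (mp d a) b

⇒-trans : ∀ {X Y Z} → GL⊢ (X ⇒ Y) → GL⊢ (Y ⇒ Z) → GL⊢ (X ⇒ Z)
⇒-trans {X} {Y} {Z} = mp₂ (tautology ((p ⇒ q) ⇒ (q ⇒ r) ⇒ p ⇒ r) (X ∷ Y ∷ Z ∷ []))

⇒-⋏ : ∀ {X Y Z} → GL⊢ (X ⇒ Y) → GL⊢ (X ⇒ Z) → GL⊢ (X ⇒ Y ⋏ Z)
⇒-⋏ {X} {Y} {Z} = mp₂ (tautology ((p ⇒ q) ⇒ (p ⇒ r) ⇒ p ⇒ q ⋏ r) (X ∷ Y ∷ Z ∷ []))

⋏-fst : ∀ {X Y} → GL⊢ (X ⋏ Y ⇒ X)
⋏-fst {X} {Y} = tautology (p ⋏ q ⇒ p) (X ∷ Y ∷ [])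

⋏-snd : ∀ {X Y} → GL⊢ (X ⋏ Y ⇒ Y)
⋏-snd {X} {Y} = tautology (p ⋏ q ⇒ q) (X ∷ Y ∷ [])

□-mono : ∀ {X Y} → GL⊢ (X ⇒ Y) → GL⊢ (□ X ⇒ □ Y)
□-mono {X} {Y} d = mp (usub (nth (X ∷ Y ∷ [])) axK) (nec d)

löb-rule : ∀ {X} → GL⊢ (□ X ⇒ X) → GL⊢ X
löb-rule {X} d = mp d (mp (usub (nth (X ∷ [])) axL) (nec d))

□-⋏ : ∀ {X Y} → GL⊢ (□ X ⋏ □ Y ⇒ □ (X ⋏ Y))
□-⋏ {X} {Y} = mp (tautology ((p ⇒ q ⇒ r) ⇒ p ⋏ q ⇒ r) (□ X ∷ □ Y ∷ □ (X ⋏ Y) ∷ []))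
  (⇒-trans (□-mono (tautology (p ⇒ q ⇒ p ⋏ q) (X ∷ Y ∷ []))) (usub (nth (Y ∷ X ⋏ Y ∷ [])) axK))

-- Axiom 4, from Löb's axiom for X ∧ □X.
□⇒□□ : ∀ X → GL⊢ (□ X ⇒ □ (□ X))
□⇒□□ X = ⇒-trans (□-mono (mp (tautology ((r ⇒ q) ⇒ p ⇒ r ⇒ p ⋏ q) (X ∷ □ X ∷ □ E ∷ [])) (□-mono ⋏-fst)))
                 (⇒-trans (usub (nth (E ∷ [])) axL) (□-mono ⋏-snd))
  where
  E : Fm
  E = X ⋏ □ X

with□ : List Fm → List Fm
with□ [] = []
with□ (D ∷ Ds) = D ∷ □ D ∷ with□ Ds

∈-with□ : ∀ {D} Ds → D ∈ Ds → D ∈ with□ Ds × □ D ∈ with□ Ds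
∈-with□ (E ∷ Ds) (here refl) = here refl , there (here refl)
∈-with□ (E ∷ Ds) (there m) = let a , b = ∈-with□ Ds m in there (there a) , there (there b)

⋀□⇒□⋀with□ : ∀ Ds → GL⊢ (⋀ (map □ Ds) ⇒ □ (⋀ (with□ Ds)))
⋀□⇒□⋀with□ [] = mp (tautology (q ⇒ p ⇒ q) (⊤' ∷ □ ⊤' ∷ [])) (nec (tautology ⊤' []))
⋀□⇒□⋀with□ (D ∷ Ds) = ⇒-trans (⇒-⋏ ⋏-fst □-tail) □-⋏
  where
  □-tail : GL⊢ (□ D ⋏ ⋀ (map □ Ds) ⇒ □ (□ D ⋏ ⋀ (with□ Ds)))
  □-tail = ⇒-trans (⇒-⋏ (⇒-trans ⋏-fst (□⇒□□ D)) (⇒-trans ⋏-snd (⋀□⇒□⋀with□ Ds))) □-⋏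

-- Kripke semantics

record Model : Set₁ where
  field
    W : Set
    succ : W → List W
    V : W → ℕ → Bool
    rank : W → ℕ
    succ-trans : ∀ {w u v} → u ∈ succ w → v ∈ succ u → v ∈ succ w
    rank-succ : ∀ {w u} → u ∈ succ w → rank u < rank w
open Model public

⟦_⟧ : Fm → (M : Model) → W M → Bool
⟦ var n ⟧ M w = V M w n
⟦ ⊤' ⟧ M w = true
⟦ ⊥' ⟧ M w = false
⟦ x ⋏ y ⟧ M w = ⟦ x ⟧ M w ∧ ⟦ y ⟧ M w
⟦ x ⋎ y ⟧ M w = ⟦ x ⟧ M w ∨ ⟦ y ⟧ M w
⟦ x ⇒ y ⟧ M w = not (⟦ x ⟧ M w) ∨ ⟦ y ⟧ M w
⟦ x ⟺ y ⟧ M w = if ⟦ x ⟧ M w then ⟦ y ⟧ M w else not (⟦ y ⟧ M w)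
⟦ ¬' x ⟧ M w = not (⟦ x ⟧ M w)
⟦ □ x ⟧ M w = all (⟦ x ⟧ M) (succ M w)

Refutes : (M : Model) → Fm → Set
Refutes M X = Σ (W M) λ w → ⟦ X ⟧ M w ≡ false

⟦⟧-eval : ∀ M w X → ⟦ X ⟧ M w ≡ eval (V M w) (λ C → ⟦ □ C ⟧ M w) X
⟦⟧-eval M w (var n) = refl
⟦⟧-eval M w ⊤' = refl
⟦⟧-eval M w ⊥' = refl
⟦⟧-eval M w (x ⋏ y) = cong₂ _∧_ (⟦⟧-eval M w x) (⟦⟧-eval M w y)
⟦⟧-eval M w (x ⋎ y) = cong₂ _∨_ (⟦⟧-eval M w x) (⟦⟧-eval M w y)
⟦⟧-eval M w (x ⇒ y) = cong₂ (λ a b → not a ∨ b) (⟦⟧-eval M w x) (⟦⟧-eval M w y)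
⟦⟧-eval M w (x ⟺ y) = cong₂ (λ a b → if a then b else not b) (⟦⟧-eval M w x) (⟦⟧-eval M w y)
⟦⟧-eval M w (¬' x) = cong not (⟦⟧-eval M w x)
⟦⟧-eval M w (□ x) = refl

revalue : (M : Model) → (W M → ℕ → Bool) → Model
revalue M V' = record M { V = V' }

⟦subst⟧ : ∀ M σ w X → ⟦ subst σ X ⟧ M w ≡ ⟦ X ⟧ (revalue M (λ u n → ⟦ σ n ⟧ M u)) w
⟦subst⟧ M σ w (var n) = refl
⟦subst⟧ M σ w ⊤' = refl
⟦subst⟧ M σ w ⊥' = refl
⟦subst⟧ M σ w (x ⋏ y) = cong₂ _∧_ (⟦subst⟧ M σ w x) (⟦subst⟧ M σ w y)
⟦subst⟧ M σ w (x ⋎ y) = cong₂ _∨_ (⟦subst⟧ M σ w x) (⟦subst⟧ M σ w y)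
⟦subst⟧ M σ w (x ⇒ y) = cong₂ (λ a b → not a ∨ b) (⟦subst⟧ M σ w x) (⟦subst⟧ M σ w y)
⟦subst⟧ M σ w (x ⟺ y) = cong₂ (λ a b → if a then b else not b) (⟦subst⟧ M σ w x) (⟦subst⟧ M σ w y)
⟦subst⟧ M σ w (¬' x) = cong not (⟦subst⟧ M σ w x)
⟦subst⟧ M σ w (□ x) = all-cong (succ M w) (λ {u} _ → ⟦subst⟧ M σ u x)

⟦subst-var⟧ : ∀ M w X → ⟦ subst var X ⟧ M w ≡ ⟦ X ⟧ M w
⟦subst-var⟧ M w X = cong (λ Y → ⟦ Y ⟧ M w) (subst-var X)

module _ (M : Model) where

  □-intro : ∀ {w} C → (∀ {u} → u ∈ succ M w → ⟦ C ⟧ M u ≡ true) → ⟦ □ C ⟧ M w ≡ true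
  □-intro {w} C = all-true⁺ (succ M w)

  □-elim : ∀ {w u} C → ⟦ □ C ⟧ M w ≡ true → u ∈ succ M w → ⟦ C ⟧ M u ≡ true
  □-elim {w} C e = all-true⁻ (succ M w) e

  □-persist : ∀ {w u} C → ⟦ □ C ⟧ M w ≡ true → u ∈ succ M w → ⟦ □ C ⟧ M u ≡ true
  □-persist C e m = □-intro C (□-elim C e ∘ succ-trans M m)

  □-refuted : ∀ {w u} C → u ∈ succ M w → ⟦ C ⟧ M u ≡ false → ⟦ □ C ⟧ M w ≡ false
  □-refuted {w} C = all-false⁺ (succ M w)

  □-false : ∀ {w} C → ⟦ □ C ⟧ M w ≡ false → Σ (W M) λ u → u ∈ succ M w × ⟦ C ⟧ M u ≡ false
  □-false {w} C = all-false⁻ (succ M w)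

  löb-valid : ∀ w → ⟦ □ (□ p ⇒ p) ⇒ □ p ⟧ M w ≡ true
  löb-valid w = not∨-intro λ H → □-intro p (λ {u} m → below (suc (rank M u)) ≤-refl m H)
    where
    below : ∀ n {u} → rank M u < n → u ∈ succ M w → ⟦ □ (□ p ⇒ p) ⟧ M w ≡ true → ⟦ p ⟧ M u ≡ true
    below (suc n) (s≤s u≤n) m H = not∨-elim (□-elim (□ p ⇒ p) H m)
      (□-intro p (λ m' → below n (≤-trans (rank-succ M m') u≤n) (succ-trans M m m') H))

sound : ∀ {X} → GL⊢ X → ∀ M w → ⟦ X ⟧ M w ≡ true
sound {X} (taut t) M w = trans (⟦⟧-eval M w X) (t _ _)
sound axK M w = not∨-intro λ e₁ → not∨-intro λ e₂ →
  □-intro M q (λ m → not∨-elim (□-elim M (p ⇒ q) e₁ m) (□-elim M p e₂ m))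
sound axL M w = löb-valid M w
sound (mp d e) M w = not∨-elim (sound d M w) (sound e M w)
sound (nec {X} d) M w = □-intro M X (λ {u} _ → sound d M u)
sound (usub {X} σ d) M w = trans (⟦subst⟧ M σ w X) (sound d _ w)

⋀Rf-true⁻ : ∀ X M w → ⟦ ⋀Rf X ⟧ M w ≡ true → ∀ {C} → C ∈ boxedArgs X → ⟦ □ C ⇒ C ⟧ M w ≡ true
⋀Rf-true⁻ X M w e m = ⋀-true⁻ (λ Y → ⟦ Y ⟧ M w) refl refl _ e (∈-map⁺ (λ B → □ B ⇒ B) (∈-dedup⁺ _ m))

⋀Rf-true⁺ : ∀ X M w → (∀ {C} → C ∈ boxedArgs X → ⟦ □ C ⇒ C ⟧ M w ≡ true) → ⟦ ⋀Rf X ⟧ M w ≡ true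
⋀Rf-true⁺ X M w h = ⋀-true⁺ (λ Y → ⟦ Y ⟧ M w) refl refl _ reflection
  where
  reflection : ∀ {Y} → Y ∈ map (λ B → □ B ⇒ B) (distinctBoxedArgs X) → ⟦ Y ⟧ M w ≡ true
  reflection m with ∈-map⁻ (λ B → □ B ⇒ B) m
  ... | C , mC , refl = h (∈-dedup⁻ _ mC)

record Embedding (M M' : Model) : Set where
  field
    embed : W M → W M'
    embed-succ : ∀ w → succ M' (embed w) ≡ map embed (succ M w)
    embed-V : ∀ w → V M' (embed w) ≡ V M w
open Embedding public

⟦⟧-embed : ∀ {M M'} (E : Embedding M M') w X → ⟦ X ⟧ M' (embed E w) ≡ ⟦ X ⟧ M w
⟦⟧-embed E w (var n) = cong (λ v → v n) (embed-V E w)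
⟦⟧-embed E w ⊤' = refl
⟦⟧-embed E w ⊥' = refl
⟦⟧-embed E w (x ⋏ y) = cong₂ _∧_ (⟦⟧-embed E w x) (⟦⟧-embed E w y)
⟦⟧-embed E w (x ⋎ y) = cong₂ _∨_ (⟦⟧-embed E w x) (⟦⟧-embed E w y)
⟦⟧-embed E w (x ⇒ y) = cong₂ (λ a b → not a ∨ b) (⟦⟧-embed E w x) (⟦⟧-embed E w y)
⟦⟧-embed E w (x ⟺ y) = cong₂ (λ a b → if a then b else not b) (⟦⟧-embed E w x) (⟦⟧-embed E w y)
⟦⟧-embed E w (¬' x) = cong not (⟦⟧-embed E w x)
⟦⟧-embed {M} {M'} E w (□ x) = begin
  all (⟦ x ⟧ M') (succ M' (embed E w))  ≡⟨ cong (all (⟦ x ⟧ M')) (embed-succ E w) ⟩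
  all (⟦ x ⟧ M') (map (embed E) (succ M w)) ≡⟨ all-map (⟦ x ⟧ M') (embed E) (succ M w) ⟩
  all (⟦ x ⟧ M' ∘ embed E) (succ M w)   ≡⟨ all-cong (succ M w) (λ {u} _ → ⟦⟧-embed E u x) ⟩
  all (⟦ x ⟧ M) (succ M w)              ∎
  where open ≡-Reasoning

module _ (M : Model) where

  rank<⇒□^⊥ : ∀ k w → rank M w < k → ⟦ □^ k ⊥' ⟧ M w ≡ true
  rank<⇒□^⊥ (suc k) w (s≤s w≤k) = □-intro M (□^ k ⊥') (λ m → rank<⇒□^⊥ k _ (≤-trans (rank-succ M m) w≤k))

  □^⊥-mono : ∀ {m n} w → m ≤ n → ⟦ □^ m ⊥' ⟧ M w ≡ true → ⟦ □^ n ⊥' ⟧ M w ≡ true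
  □^⊥-mono {n = zero} w z≤n e = e
  □^⊥-mono {zero} {suc n} w z≤n ()
  □^⊥-mono {suc m} {suc n} w (s≤s m≤n) e = □-intro M (□^ n ⊥') (λ u → □^⊥-mono _ m≤n (□-elim M (□^ m ⊥') e u))

  ⟦□^¬⊤⟧ : ∀ n w → ⟦ □^ n (¬' ⊤') ⟧ M w ≡ ⟦ □^ n ⊥' ⟧ M w
  ⟦□^¬⊤⟧ zero w = refl
  ⟦□^¬⊤⟧ (suc n) w = all-cong (succ M w) (λ {u} _ → ⟦□^¬⊤⟧ n u)

  ⟦◇^⊤⟧ : ∀ n w → ⟦ ◇^ n ⊤' ⟧ M w ≡ not (⟦ □^ n ⊥' ⟧ M w)
  ⟦◇^⊤⟧ n w = cong not (⟦□^¬⊤⟧ n w)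

  ◇^⊤⇒¬□^⊥ : ∀ n w → ⟦ ◇^ n ⊤' ⟧ M w ≡ true → ⟦ □^ n ⊥' ⟧ M w ≡ false
  ◇^⊤⇒¬□^⊥ n w e = not-true (trans (sym (⟦◇^⊤⟧ n w)) e)

  ¬□^⊥⇒◇^⊤ : ∀ n w → ⟦ □^ n ⊥' ⟧ M w ≡ false → ⟦ ◇^ n ⊤' ⟧ M w ≡ true
  ¬□^⊥⇒◇^⊤ n w e = trans (⟦◇^⊤⟧ n w) (cong not e)

  ◇^⊤-antitone : ∀ {m n} w → m ≤ n → ⟦ ◇^ n ⊤' ⟧ M w ≡ true → ⟦ ◇^ m ⊤' ⟧ M w ≡ true
  ◇^⊤-antitone {m} {n} w m≤n e = ¬□^⊥⇒◇^⊤ m w (¬-not λ □m → not-¬ (□^⊥-mono w m≤n □m) (◇^⊤⇒¬□^⊥ n w e))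

-- Completeness: a finite canonical model

Consistent : List Fm → Set
Consistent Γ = ¬ (GL⊢ ¬' (⋀ Γ))

Satisfies : (ℕ → Bool) → (Fm → Bool) → List Fm → Set
Satisfies v b Γ = ∀ {x} → x ∈ Γ → eval v b x ≡ true

consistent-⊢ : ∀ Γ {Y} → Consistent Γ → GL⊢ Y → ¬ (∀ v b → Satisfies v b Γ → eval v b Y ≡ false)
consistent-⊢ Γ {Y} con d refute = con (mp (taut {Y ⇒ ¬' (⋀ Γ)} t) d)
  where
  t : Tautology (Y ⇒ ¬' (⋀ Γ))
  t v b with eval v b (⋀ Γ) in e
  ... | false = ∨-zeroʳ (not (eval v b Y))
  ... | true rewrite refute v b (⋀-true⁻ (eval v b) refl refl Γ e) = refl

consistent-entails : ∀ Γ {a c : Bool} → Consistent Γ → (∀ v b → Satisfies v b Γ → a ≡ c) → a ≡ c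
consistent-entails Γ con f = decidable-stable (_ Bool.≟ _) λ a≢c →
  consistent-⊢ Γ con (tautology ⊤' []) λ v b sat → ⊥-elim (a≢c (f v b sat))

consistent-⊆ : ∀ {Γ₁ Γ₂} → Γ₂ ⊆ Γ₁ → Consistent Γ₁ → Consistent Γ₂
consistent-⊆ {Γ₁} {Γ₂} Γ₂⊆Γ₁ con d = consistent-⊢ Γ₁ con d λ v b sat →
  cong not (⋀-true⁺ (eval v b) refl refl Γ₂ (sat ∘ Γ₂⊆Γ₁))

lit : Fm → Bool → Fm
lit D true = D
lit D false = ¬' D

lits : List Fm → List Bool → List Fm
lits (D ∷ Ψ) (c ∷ cs) = lit D c ∷ lits Ψ cs
lits _ _ = []

-- The value cs gives to the first occurrence of C in Ψ (false if C ∉ Ψ).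
valueIn : List Fm → List Bool → Fm → Bool
valueIn (D ∷ Ψ) (c ∷ cs) C = if D == C then c else valueIn Ψ cs C
valueIn _ _ C = false

eval-lit : ∀ v b D c → eval v b (lit D c) ≡ true → eval v b D ≡ c
eval-lit v b D true e = e
eval-lit v b D false e = not-true e

eval-lits : ∀ v b Ψ cs → length cs ≡ length Ψ → Satisfies v b (lits Ψ cs) →
  ∀ {C} → C ∈ Ψ → eval v b C ≡ valueIn Ψ cs C
eval-lits v b (D ∷ Ψ) (c ∷ cs) _ sat {C} (here refl)
  rewrite Equivalence.to T-≡ (==-refl C) = eval-lit v b C c (sat (here refl))
eval-lits v b (D ∷ Ψ) (c ∷ cs) eq sat {C} (there m) with D == C in D==C
... | true with ==-sound D C (Equivalence.from T-≡ D==C)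
...   | refl = eval-lit v b C c (sat (here refl))
eval-lits v b (D ∷ Ψ) (c ∷ cs) eq sat {C} (there m) | false =
  eval-lits v b Ψ cs (suc-injective eq) (sat ∘ there) m

lindenbaum : ∀ Ψ Γ → Consistent Γ → ¬ ¬ (Σ (List Bool) λ cs → length cs ≡ length Ψ × Consistent (lits Ψ cs ++ Γ))
lindenbaum [] Γ con k = k ([] , refl , con)
lindenbaum (D ∷ Ψ) Γ con k = one-side λ { (inj₁ c₁) → extend true c₁ ; (inj₂ c₂) → extend false c₂ }
  where
  one-side : ¬ ¬ (Consistent (D ∷ Γ) ⊎ Consistent (¬' D ∷ Γ))
  one-side k' = k' (inj₁ λ d₁ → k' (inj₂ λ d₂ →
    con (mp₂ (tautology (¬' (p ⋏ q) ⇒ ¬' (¬' p ⋏ q) ⇒ ¬' q) (D ∷ ⋀ Γ ∷ [])) d₁ d₂)))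
  extend : ∀ c → Consistent (lit D c ∷ Γ) → ⊥
  extend c con' = lindenbaum Ψ (lit D c ∷ Γ) con' λ (cs , eq , con'') →
    k (c ∷ cs , cong suc eq , consistent-⊆ (move {cs}) con'')
    where
    move : ∀ {cs} → lit D c ∷ (lits Ψ cs ++ Γ) ⊆ lits Ψ cs ++ (lit D c ∷ Γ)
    move {cs} (here refl) = ∈-++⁺ʳ (lits Ψ cs) (here refl)
    move {cs} (there m) = [ ∈-++⁺ˡ , ∈-++⁺ʳ (lits Ψ cs) ∘ there ]′ (∈-++⁻ (lits Ψ cs) m)

-- Worlds are the consistent truth assignments to Sub(X).  Consistency is only ¬¬-decidable, which suffices
-- because the model is only ever used to derive a contradiction.
module Canonical (X : Fm) (L : List Fm) (L⊇ : boxedArgs X ⊆ L) (L⊆ : L ⊆ boxedArgs X)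
  (decided : All (λ cs → Dec (Consistent (lits (sub X) cs))) (bools (length (sub X)))) where

  Φ : List Fm
  Φ = sub X

  worlds : List (List Bool)
  worlds = select (bools (length Φ)) decided

  world-consistent : ∀ {w} → w ∈ worlds → Consistent (lits Φ w)
  world-consistent m = proj₂ (∈-select⁻ _ decided m)

  world-length : ∀ {w} → w ∈ worlds → length w ≡ length Φ
  world-length m = ∈-bools⁻ (length Φ) (proj₁ (∈-select⁻ _ decided m))

  world-intro : ∀ {w} → length w ≡ length Φ → Consistent (lits Φ w) → w ∈ worlds
  world-intro {w} eq con = ∈-select⁺ _ decided (≡-subst (λ n → w ∈ bools n) eq ∈-bools⁺) con

  extension-world : ∀ {u Δ} → length u ≡ length Φ → Consistent (lits Φ u ++ Δ) → u ∈ worlds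
  extension-world {u} {Δ} eq con = world-intro eq (consistent-⊆ {lits Φ u ++ Δ} {lits Φ u} ∈-++⁺ˡ con)

  val : List Bool → Fm → Bool
  val = valueIn Φ

  Agrees : List Bool → (ℕ → Bool) → (Fm → Bool) → Set
  Agrees w v b = ∀ {C} → C ∈ Φ → eval v b C ≡ val w C

  extension-entails : ∀ {w Δ} {a c : Bool} → length w ≡ length Φ → Consistent (lits Φ w ++ Δ) →
    (∀ v b → Agrees w v b → Satisfies v b Δ → a ≡ c) → a ≡ c
  extension-entails {w} eq con f = consistent-entails (lits Φ w ++ _) con λ v b sat →
    f v b (eval-lits v b Φ w eq (sat ∘ ∈-++⁺ˡ)) (sat ∘ ∈-++⁺ʳ (lits Φ w))

  world-entails : ∀ {w} {a c : Bool} → w ∈ worlds → (∀ v b → Agrees w v b → a ≡ c) → a ≡ c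
  world-entails {w} m f = consistent-entails (lits Φ w) (world-consistent m) λ v b sat →
    f v b (eval-lits v b Φ w (world-length m) sat)

  world-⊢ : ∀ {w Y} → w ∈ worlds → GL⊢ Y → ¬ (∀ v b → Agrees w v b → eval v b Y ≡ false)
  world-⊢ {w} m d refute = consistent-⊢ (lits Φ w) (world-consistent m) d λ v b sat →
    refute v b (eval-lits v b Φ w (world-length m) sat)

  -- The new □C required of a successor makes □-count grow along R, which bounds the rank.
  □-inherited : List Bool → List Bool → Fm → Bool
  □-inherited w u C = not (val w (□ C)) ∨ (val u C ∧ val u (□ C))

  □-new : List Bool → List Bool → Fm → Bool
  □-new w u C = val u (□ C) ∧ not (val w (□ C))

  R? : List Bool → List Bool → Bool
  R? w u = all (□-inherited w u) (boxedArgs X) ∧ any (□-new w u) (boxedArgs X)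

  R-inherited : ∀ {w u C} → R? w u ≡ true → C ∈ boxedArgs X → val w (□ C) ≡ true →
    val u C ≡ true × val u (□ C) ≡ true
  R-inherited {w} {u} {C} r m e =
    let both = not∨-elim (all-true⁻ (boxedArgs X) (∧-conicalˡ (all (□-inherited w u) (boxedArgs X)) _ r) m) e
    in ∧-conicalˡ _ _ both , ∧-conicalʳ (val u C) _ both

  R-new : ∀ {w u} → R? w u ≡ true → Σ Fm λ C → C ∈ boxedArgs X × val u (□ C) ≡ true × val w (□ C) ≡ false
  R-new {w} {u} r = let C , m , e = any-true⁻ (boxedArgs X) (∧-conicalʳ (all (□-inherited w u) (boxedArgs X)) _ r)
                    in C , m , ∧-conicalˡ _ _ e , not-true (∧-conicalʳ (val u (□ C)) _ e)

  R-intro : ∀ {w u} → (∀ {C} → C ∈ boxedArgs X → val w (□ C) ≡ true → val u C ≡ true × val u (□ C) ≡ true) →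
    ∀ {C} → C ∈ boxedArgs X → val u (□ C) ≡ true → val w (□ C) ≡ false → R? w u ≡ true
  R-intro inherit m e₁ e₂ = ∧-true (all-true⁺ _ λ m' → not∨-intro λ e → let a , b = inherit m' e in ∧-true a b)
                                  (any-true⁺ _ m (∧-true e₁ (cong not e₂)))

  R-trans : ∀ {w u v} → R? w u ≡ true → R? u v ≡ true → R? w v ≡ true
  R-trans {w} r₁ r₂ = let C , m , e₁ , e₂ = R-new r₂ in
    R-intro (λ m' e → R-inherited r₂ m' (proj₂ (R-inherited r₁ m' e))) m e₁
            (¬-not λ e → not-¬ (proj₂ (R-inherited r₁ m e)) e₂)

  □-count : List Bool → ℕ
  □-count w = countᵇ (λ C → val w (□ C)) L

  R-□-count : ∀ {w u} → R? w u ≡ true → □-count w < □-count u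
  R-□-count r = let C , m , e₁ , e₂ = R-new r in
    countᵇ-strict _ _ L (λ m' e → proj₂ (R-inherited r (L⊆ m') e)) (L⊇ m) e₂ e₁

  succ-R⁻ : ∀ {w u} → u ∈ filterᵇ (R? w) worlds → u ∈ worlds × R? w u ≡ true
  succ-R⁻ {w} = ∈-filterᵇ⁻ {p = R? w}

  succ-R⁺ : ∀ {w u} → u ∈ worlds → R? w u ≡ true → u ∈ filterᵇ (R? w) worlds
  succ-R⁺ {w} = ∈-filterᵇ⁺ {p = R? w}

  M : Model
  M = record
    { W = List Bool
    ; succ = λ w → filterᵇ (R? w) worlds
    ; V = λ w n → val w (var n)
    ; rank = λ w → length L ∸ □-count w
    ; succ-trans = λ m₁ m₂ → succ-R⁺ (proj₁ (succ-R⁻ m₂)) (R-trans (proj₂ (succ-R⁻ m₁)) (proj₂ (succ-R⁻ m₂)))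
    ; rank-succ = λ m → ∸-monoʳ-< (R-□-count (proj₂ (succ-R⁻ m))) (countᵇ≤length _ L)
    }

  child : ∀ {Y Z} → Y ∈ Φ → Z ∈ sub Y → Z ∈ Φ
  child m = sub-trans X m

  left∈sub : ∀ {Y} a {xs} → a ∈ Y ∷ sub a ++ xs
  left∈sub a = there (∈-++⁺ˡ (sub-refl a))

  right∈sub : ∀ {Y} xs c → c ∈ Y ∷ xs ++ sub c
  right∈sub xs c = there (∈-++⁺ʳ xs (sub-refl c))

  boxedTrue : List Bool → List Fm
  boxedTrue w = filterᵇ (λ D → val w (□ D)) (boxedArgs X)

  -- Otherwise Löb's axiom would derive ⋀{□D | □D true at w} → □C, which w refutes.
  löb-consistent : ∀ {C w} → □ C ∈ Φ → w ∈ worlds → val w (□ C) ≡ false →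
    Consistent (¬' C ∷ □ C ∷ with□ (boxedTrue w))
  löb-consistent {C} {w} m g w□C d =
    world-⊢ g (⇒-trans (⋀□⇒□⋀with□ Ds) (⇒-trans (□-mono reflected) (usub (nth (C ∷ [])) axL))) refute
    where
    Ds : List Fm
    Ds = boxedTrue w
    reflected : GL⊢ (⋀ (with□ Ds) ⇒ □ C ⇒ C)
    reflected = mp (tautology (¬' (¬' p ⋏ q ⋏ r) ⇒ r ⇒ q ⇒ p) (C ∷ □ C ∷ ⋀ (with□ Ds) ∷ [])) d
    boxes-true : ∀ v b → Agrees w v b → eval v b (⋀ (map □ Ds)) ≡ true
    boxes-true v b agree = ⋀-true⁺ (eval v b) refl refl (map □ Ds) λ mx →
      let D , mD , eq = ∈-map⁻ □ mx ; mB , e = ∈-filterᵇ⁻ mD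
      in ≡-subst (λ x → eval v b x ≡ true) (sym eq) (trans (agree (boxedArg⇒□∈sub X mB)) e)
    refute : ∀ v b → Agrees w v b → eval v b (⋀ (map □ Ds) ⇒ □ C) ≡ false
    refute v b agree rewrite boxes-true v b agree | agree m = w□C

  successor-refuting : ∀ {C w} → □ C ∈ Φ → w ∈ worlds → val w (□ C) ≡ false →
    ¬ ¬ (Σ (List Bool) λ u → u ∈ succ M w × val u C ≡ false)
  successor-refuting {C} {w} m g w□C k =
    lindenbaum Φ (¬' C ∷ □ C ∷ with□ (boxedTrue w)) (löb-consistent m g w□C) λ (u , eq , con) → k (successor eq con)
    where
    successor : ∀ {u} → length u ≡ length Φ → Consistent (lits Φ u ++ ¬' C ∷ □ C ∷ with□ (boxedTrue w)) →
      Σ (List Bool) λ u' → u' ∈ succ M w × val u' C ≡ false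
    successor {u} eq con = u , succ-R⁺ (extension-world eq con) (R-intro inherit mC u□C w□C) , uC
      where
      mC : C ∈ boxedArgs X
      mC = □∈sub⇒boxedArg X m
      C∈Φ : C ∈ Φ
      C∈Φ = child m (there (sub-refl C))
      uC : val u C ≡ false
      uC = extension-entails eq con λ v b agree sat → trans (sym (agree C∈Φ)) (not-true (sat (here refl)))
      holds : ∀ {Z} → Z ∈ Φ → Z ∈ ¬' C ∷ □ C ∷ with□ (boxedTrue w) → val u Z ≡ true
      holds mZ mΔ = extension-entails eq con λ v b agree sat → trans (sym (agree mZ)) (sat mΔ)
      u□C : val u (□ C) ≡ true
      u□C = holds m (there (here refl))
      inherit : ∀ {D} → D ∈ boxedArgs X → val w (□ D) ≡ true → val u D ≡ true × val u (□ D) ≡ true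
      inherit mD e = let D∈ , □D∈ = ∈-with□ _ (∈-filterᵇ⁺ mD e) in
        holds (boxedArg⇒∈sub X mD) (there (there D∈)) , holds (boxedArg⇒□∈sub X mD) (there (there □D∈))

  □-lemma : ∀ {C w} → □ C ∈ Φ → w ∈ worlds → all (λ u → val u C) (succ M w) ≡ val w (□ C)
  □-lemma {C} {w} m g = ≡true-ext no-refuting-successor inherited
    where
    inherited : val w (□ C) ≡ true → all (λ u → val u C) (succ M w) ≡ true
    inherited e = all-true⁺ (succ M w) λ mu → proj₁ (R-inherited (proj₂ (succ-R⁻ mu)) (□∈sub⇒boxedArg X m) e)
    no-refuting-successor : all (λ u → val u C) (succ M w) ≡ true → val w (□ C) ≡ true
    no-refuting-successor all-C = decidable-stable (_ Bool.≟ true) λ w□C≢true →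
      successor-refuting m g (¬-not w□C≢true) λ (u , mu , uC) →
        not-¬ (all-true⁻ (succ M w) all-C mu) uC

  truth-binary : ∀ (_⋆_ : Bool → Bool → Bool) {w Y a c} → w ∈ worlds → Y ∈ Φ → a ∈ sub Y → c ∈ sub Y →
    (∀ v b → eval v b Y ≡ eval v b a ⋆ eval v b c) →
    (a ∈ Φ → ⟦ a ⟧ M w ≡ val w a) → (c ∈ Φ → ⟦ c ⟧ M w ≡ val w c) → ⟦ a ⟧ M w ⋆ ⟦ c ⟧ M w ≡ val w Y
  truth-binary _⋆_ g mY ma mc compositional ta tc =
    trans (cong₂ _⋆_ (ta (child mY ma)) (tc (child mY mc))) (world-entails g λ v b agree →
      trans (cong₂ _⋆_ (sym (agree (child mY ma))) (sym (agree (child mY mc))))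
            (trans (sym (compositional v b)) (agree mY)))

  truth : ∀ {Y} → Y ∈ Φ → ∀ {w} → w ∈ worlds → ⟦ Y ⟧ M w ≡ val w Y
  truth {var n} m g = refl
  truth {⊤'} m g = world-entails g λ v b agree → agree m
  truth {⊥'} m g = world-entails g λ v b agree → agree m
  truth {a ⋏ c} m g = truth-binary _∧_ g m (left∈sub a) (right∈sub (sub a) c) (λ _ _ → refl)
    (λ ma → truth ma g) (λ mc → truth mc g)
  truth {a ⋎ c} m g = truth-binary _∨_ g m (left∈sub a) (right∈sub (sub a) c) (λ _ _ → refl)
    (λ ma → truth ma g) (λ mc → truth mc g)
  truth {a ⇒ c} m g = truth-binary (λ x y → not x ∨ y) g m (left∈sub a) (right∈sub (sub a) c) (λ _ _ → refl)
    (λ ma → truth ma g) (λ mc → truth mc g)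
  truth {a ⟺ c} m g = truth-binary (λ x y → if x then y else not y) g m (left∈sub a) (right∈sub (sub a) c)
    (λ _ _ → refl) (λ ma → truth ma g) (λ mc → truth mc g)
  truth {¬' a} m g = trans (cong not (truth (child m (there (sub-refl a))) g))
    (world-entails g λ v b agree → trans (cong not (sym (agree (child m (there (sub-refl a)))))) (agree m))
  truth {□ C} m {w} g =
    trans (all-cong (succ M w) λ mu → truth (child m (there (sub-refl C))) (proj₁ (succ-R⁻ mu))) (□-lemma m g)

  refutes : ∀ {Y} → Y ∈ Φ → ¬ GL⊢ Y → ¬ ¬ Refutes M Y
  refutes {Y} m ⊬Y k = lindenbaum Φ (¬' Y ∷ []) consistent λ (u , eq , con) →
    k (u , trans (truth m (extension-world eq con))
                 (extension-entails eq con λ v b agree sat → trans (sym (agree m)) (not-true (sat (here refl)))))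
    where
    consistent : Consistent (¬' Y ∷ [])
    consistent d = ⊬Y (mp (tautology (¬' (¬' p ⋏ ⊤') ⇒ p) (Y ∷ [])) d)

completeness : ∀ X L → boxedArgs X ⊆ L → L ⊆ boxedArgs X →
  ¬ ¬ (Σ Model λ M → (∀ w → rank M w ≤ length L) × (∀ {Y} → Y ∈ sub X → ¬ GL⊢ Y → ¬ ¬ Refutes M Y))
completeness X L L⊇ L⊆ k = ¬¬-decide-all (bools (length (sub X))) λ decided → let open Canonical X L L⊇ L⊆ decided in
  k (M , (λ w → m∸n≤m (length L) (□-count w)) , refutes)

countermodel : ∀ X → ¬ GL⊢ X → ¬ ¬ (Σ Model λ M → Refutes M X)
countermodel X ⊬X k = completeness X (boxedArgs X) id id λ (M , _ , refutes) → refutes (sub-refl X) ⊬X λ r → k (M , r)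

-- Models built from a given one

Eventually : ∀ {ℓ} → (ℕ → Set ℓ) → Set ℓ
Eventually P = Σ ℕ λ K → ∀ {k} → K ≤ k → P k

eventually-× : ∀ {ℓ} {P Q : ℕ → Set ℓ} → Eventually P → Eventually Q → Eventually (λ k → P k × Q k)
eventually-× (K₁ , h₁) (K₂ , h₂) = K₁ ⊔ K₂ , λ le → h₁ (≤-trans (m≤m⊔n K₁ K₂) le) , h₂ (≤-trans (m≤n⊔m K₁ K₂) le)

EventuallyConstant : (ℕ → Bool) → Set
EventuallyConstant f = Σ Bool λ c → Eventually (λ k → f k ≡ c)

eventuallyConstant-op : ∀ (_∙_ : Bool → Bool → Bool) {f g} → EventuallyConstant f → EventuallyConstant g →
  EventuallyConstant (λ k → f k ∙ g k)
eventuallyConstant-op _∙_ (c , ef) (d , eg) =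
  c ∙ d , let K , h = eventually-× ef eg in K , λ le → let e₁ , e₂ = h le in cong₂ _∙_ e₁ e₂

-- w₀ followed by an ascending chain of copies τ 0, τ 1, … of w₀, where τ k sees the successors of w₀ and
-- every τ j with j < k.
module Tail (M : Model) (w₀ : W M) where

  W⁺ : Set
  W⁺ = W M ⊎ ℕ

  succ⁺ : W⁺ → List W⁺
  succ⁺ (inj₁ w) = map inj₁ (succ M w)
  succ⁺ (inj₂ k) = map inj₁ (succ M w₀) ++ map inj₂ (downFrom k)

  ∈-succ⁺-τ⁻ : ∀ {k v} → v ∈ succ⁺ (inj₂ k) →
    (Σ (W M) λ u → v ≡ inj₁ u × u ∈ succ M w₀) ⊎ (Σ ℕ λ j → v ≡ inj₂ j × j < k)
  ∈-succ⁺-τ⁻ m with ∈-++⁻ (map inj₁ (succ M w₀)) m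
  ... | inj₁ m₁ = let u , mu , eq = ∈-map⁻ inj₁ m₁ in inj₁ (u , eq , mu)
  ... | inj₂ m₂ = let j , mj , eq = ∈-map⁻ inj₂ m₂ in inj₂ (j , eq , ∈-downFrom⁻ mj)

  succ⁺-trans : ∀ {w u v} → u ∈ succ⁺ w → v ∈ succ⁺ u → v ∈ succ⁺ w
  succ⁺-trans {inj₁ w} m₁ m₂ with ∈-map⁻ inj₁ m₁
  ... | _ , ma , refl with ∈-map⁻ inj₁ m₂
  ...   | _ , mb , refl = ∈-map⁺ inj₁ (succ-trans M ma mb)
  succ⁺-trans {inj₂ k} m₁ m₂ with ∈-succ⁺-τ⁻ m₁
  ... | inj₁ (_ , refl , ma) with ∈-map⁻ inj₁ m₂
  ...   | _ , mb , refl = ∈-++⁺ˡ (∈-map⁺ inj₁ (succ-trans M ma mb))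
  succ⁺-trans {inj₂ k} m₁ m₂ | inj₂ (_ , refl , j<k) with ∈-succ⁺-τ⁻ m₂
  ... | inj₁ (_ , refl , mb) = ∈-++⁺ˡ (∈-map⁺ inj₁ mb)
  ... | inj₂ (_ , refl , i<j) = ∈-++⁺ʳ _ (∈-map⁺ inj₂ (∈-downFrom⁺ (<-trans i<j j<k)))

  rank⁺ : W⁺ → ℕ
  rank⁺ (inj₁ w) = rank M w
  rank⁺ (inj₂ k) = rank M w₀ + k

  rank⁺-succ : ∀ {w u} → u ∈ succ⁺ w → rank⁺ u < rank⁺ w
  rank⁺-succ {inj₁ w} m with ∈-map⁻ inj₁ m
  ... | _ , mu , refl = rank-succ M mu
  rank⁺-succ {inj₂ k} m with ∈-succ⁺-τ⁻ m
  ... | inj₁ (_ , refl , mu) = <-≤-trans (rank-succ M mu) (m≤m+n (rank M w₀) k)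
  ... | inj₂ (_ , refl , j<k) = +-monoʳ-< (rank M w₀) j<k

  M⁺ : Model
  M⁺ = record
    { W = W⁺
    ; succ = succ⁺
    ; V = [ V M , (λ _ → V M w₀) ]′
    ; rank = rank⁺
    ; succ-trans = λ {w} → succ⁺-trans {w}
    ; rank-succ = λ {w} → rank⁺-succ {w}
    }

  ι : Embedding M M⁺
  ι = record { embed = inj₁ ; embed-succ = λ w → refl ; embed-V = λ w → refl }

  τ : ℕ → W M⁺
  τ = inj₂

  ⟦□⟧-τ : ∀ k C → ⟦ □ C ⟧ M⁺ (τ k) ≡ ⟦ □ C ⟧ M w₀ ∧ all (λ j → ⟦ C ⟧ M⁺ (τ j)) (downFrom k)
  ⟦□⟧-τ k C = begin
    all (⟦ C ⟧ M⁺) (map inj₁ (succ M w₀) ++ map inj₂ (downFrom k))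
      ≡⟨ all-++ (⟦ C ⟧ M⁺) (map inj₁ (succ M w₀)) (map inj₂ (downFrom k)) ⟩
    all (⟦ C ⟧ M⁺) (map inj₁ (succ M w₀)) ∧ all (⟦ C ⟧ M⁺) (map inj₂ (downFrom k))
      ≡⟨ cong₂ _∧_ (⟦⟧-embed ι w₀ (□ C)) (all-map (⟦ C ⟧ M⁺) inj₂ (downFrom k)) ⟩
    ⟦ □ C ⟧ M w₀ ∧ all (λ j → ⟦ C ⟧ M⁺ (τ j)) (downFrom k) ∎
    where open ≡-Reasoning

  □-τ⁻ : ∀ {k} C → ⟦ □ C ⟧ M⁺ (τ k) ≡ true → ⟦ □ C ⟧ M w₀ ≡ true × (∀ {j} → j < k → ⟦ C ⟧ M⁺ (τ j) ≡ true)
  □-τ⁻ {k} C e = let e' = trans (sym (⟦□⟧-τ k C)) e in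
    ∧-conicalˡ _ _ e' , λ j<k → all-true⁻ (downFrom k) (∧-conicalʳ _ _ e') (∈-downFrom⁺ j<k)

  □-τ⁺ : ∀ {k} C → ⟦ □ C ⟧ M w₀ ≡ true → (∀ {j} → j < k → ⟦ C ⟧ M⁺ (τ j) ≡ true) → ⟦ □ C ⟧ M⁺ (τ k) ≡ true
  □-τ⁺ {k} C e h = trans (⟦□⟧-τ k C) (∧-true e (all-true⁺ (downFrom k) (h ∘ ∈-downFrom⁻)))

  ⟦⟧-τ₀ : ∀ Y → ⟦ Y ⟧ M⁺ (τ 0) ≡ ⟦ Y ⟧ M w₀
  ⟦⟧-τ₀ (var n) = refl
  ⟦⟧-τ₀ ⊤' = refl
  ⟦⟧-τ₀ ⊥' = refl
  ⟦⟧-τ₀ (x ⋏ y) = cong₂ _∧_ (⟦⟧-τ₀ x) (⟦⟧-τ₀ y)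
  ⟦⟧-τ₀ (x ⋎ y) = cong₂ _∨_ (⟦⟧-τ₀ x) (⟦⟧-τ₀ y)
  ⟦⟧-τ₀ (x ⇒ y) = cong₂ (λ a b → not a ∨ b) (⟦⟧-τ₀ x) (⟦⟧-τ₀ y)
  ⟦⟧-τ₀ (x ⟺ y) = cong₂ (λ a b → if a then b else not b) (⟦⟧-τ₀ x) (⟦⟧-τ₀ y)
  ⟦⟧-τ₀ (¬' x) = cong not (⟦⟧-τ₀ x)
  ⟦⟧-τ₀ (□ x) = trans (⟦□⟧-τ 0 x) (∧-identityʳ _)

  ⟦⟧-τ-reflected : ∀ Y → (∀ {C} → C ∈ boxedArgs Y → ⟦ □ C ⇒ C ⟧ M w₀ ≡ true) → ∀ k → ⟦ Y ⟧ M⁺ (τ k) ≡ ⟦ Y ⟧ M w₀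
  ⟦⟧-τ-reflected (var n) rf k = refl
  ⟦⟧-τ-reflected ⊤' rf k = refl
  ⟦⟧-τ-reflected ⊥' rf k = refl
  ⟦⟧-τ-reflected (x ⋏ y) rf k =
    cong₂ _∧_ (⟦⟧-τ-reflected x (rf ∘ ∈-++⁺ˡ) k) (⟦⟧-τ-reflected y (rf ∘ ∈-++⁺ʳ _) k)
  ⟦⟧-τ-reflected (x ⋎ y) rf k =
    cong₂ _∨_ (⟦⟧-τ-reflected x (rf ∘ ∈-++⁺ˡ) k) (⟦⟧-τ-reflected y (rf ∘ ∈-++⁺ʳ _) k)
  ⟦⟧-τ-reflected (x ⇒ y) rf k =
    cong₂ (λ a b → not a ∨ b) (⟦⟧-τ-reflected x (rf ∘ ∈-++⁺ˡ) k) (⟦⟧-τ-reflected y (rf ∘ ∈-++⁺ʳ _) k)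
  ⟦⟧-τ-reflected (x ⟺ y) rf k =
    cong₂ (λ a b → if a then b else not b) (⟦⟧-τ-reflected x (rf ∘ ∈-++⁺ˡ) k) (⟦⟧-τ-reflected y (rf ∘ ∈-++⁺ʳ _) k)
  ⟦⟧-τ-reflected (¬' x) rf k = cong not (⟦⟧-τ-reflected x rf k)
  ⟦⟧-τ-reflected (□ x) rf k = begin
    ⟦ □ x ⟧ M⁺ (τ k)                                  ≡⟨ ⟦□⟧-τ k x ⟩
    ⟦ □ x ⟧ M w₀ ∧ all (λ j → ⟦ x ⟧ M⁺ (τ j)) (downFrom k) ≡⟨ cong (⟦ □ x ⟧ M w₀ ∧_) copies ⟩
    ⟦ □ x ⟧ M w₀ ∧ all (λ _ → ⟦ x ⟧ M w₀) (downFrom k)     ≡⟨ reflected (rf (here refl)) ⟩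
    ⟦ □ x ⟧ M w₀                                       ∎
    where
    open ≡-Reasoning
    copies : all (λ j → ⟦ x ⟧ M⁺ (τ j)) (downFrom k) ≡ all (λ _ → ⟦ x ⟧ M w₀) (downFrom k)
    copies = all-cong (downFrom k) (λ {j} _ → ⟦⟧-τ-reflected x (rf ∘ there) j)
    reflected : ⟦ □ x ⇒ x ⟧ M w₀ ≡ true → ⟦ □ x ⟧ M w₀ ∧ all (λ _ → ⟦ x ⟧ M w₀) (downFrom k) ≡ ⟦ □ x ⟧ M w₀
    reflected e with ⟦ □ x ⟧ M w₀
    ... | false = refl
    ... | true rewrite e = all-const-true (downFrom k)

  τ-□^⊥-false : ∀ k → ⟦ □^ k ⊥' ⟧ M⁺ (τ k) ≡ false
  τ-□^⊥-false zero = refl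
  τ-□^⊥-false (suc k) rewrite ⟦□⟧-τ (suc k) (□^ k ⊥') | τ-□^⊥-false k = ∧-zeroʳ _

  τ-□^⊥⁻ : ∀ m k → ⟦ □^ (k + m) ⊥' ⟧ M⁺ (τ m) ≡ true → ⟦ □^ k ⊥' ⟧ M w₀ ≡ true
  τ-□^⊥⁻ zero k e rewrite +-identityʳ k = trans (sym (⟦⟧-τ₀ (□^ k ⊥'))) e
  τ-□^⊥⁻ (suc m) k e rewrite +-suc k m = τ-□^⊥⁻ m k (proj₂ (□-τ⁻ (□^ (k + m) ⊥') e) ≤-refl)

  τ-□^⊥⁺ : ∀ {k} → ⟦ □^ k ⊥' ⟧ M w₀ ≡ true → ∀ m {j} → j ≤ m → ⟦ □^ (k + j) ⊥' ⟧ M⁺ (τ j) ≡ true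
  τ-□^⊥⁺ {k} e m {zero} _ = trans (⟦⟧-τ₀ (□^ (k + 0) ⊥')) (□^⊥-mono M w₀ (m≤m+n k 0) e)
  τ-□^⊥⁺ {k} e (suc m) {suc j} (s≤s j≤m) rewrite +-suc k j =
    □-τ⁺ (□^ (k + j) ⊥') (□^⊥-mono M w₀ (m≤n⇒m≤1+n (m≤m+n k j)) e) λ {i} i<1+j →
      □^⊥-mono M⁺ (τ i) (+-monoʳ-≤ k (≤-pred i<1+j)) (τ-□^⊥⁺ {k} e m (≤-trans (≤-pred i<1+j) j≤m))

  τ-□^⊥ : ∀ m k → ⟦ □^ (k + m) ⊥' ⟧ M⁺ (τ m) ≡ ⟦ □^ k ⊥' ⟧ M w₀
  τ-□^⊥ m k = ≡true-ext (τ-□^⊥⁻ m k) (λ e → τ-□^⊥⁺ {k} e m ≤-refl)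

  τ-stable : ∀ Y → EventuallyConstant (λ k → ⟦ Y ⟧ M⁺ (τ k))
  τ-stable (var n) = _ , 0 , λ _ → refl
  τ-stable ⊤' = _ , 0 , λ _ → refl
  τ-stable ⊥' = _ , 0 , λ _ → refl
  τ-stable (x ⋏ y) = eventuallyConstant-op _∧_ (τ-stable x) (τ-stable y)
  τ-stable (x ⋎ y) = eventuallyConstant-op _∨_ (τ-stable x) (τ-stable y)
  τ-stable (x ⇒ y) = eventuallyConstant-op (λ a b → not a ∨ b) (τ-stable x) (τ-stable y)
  τ-stable (x ⟺ y) = eventuallyConstant-op (λ a b → if a then b else not b) (τ-stable x) (τ-stable y)
  τ-stable (¬' x) = let c , K , h = τ-stable x in not c , K , cong not ∘ h
  τ-stable (□ x) = let c , K , h = τ-stable x in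
    ⟦ □ x ⟧ M⁺ (τ (suc K)) , suc K , λ K<k → ≡true-ext (shrink K<k) (grow h K<k)
    where
    shrink : ∀ {K k} → K ≤ k → ⟦ □ x ⟧ M⁺ (τ k) ≡ true → ⟦ □ x ⟧ M⁺ (τ K) ≡ true
    shrink K≤k e = let base , below = □-τ⁻ x e in □-τ⁺ x base (λ j<K → below (<-≤-trans j<K K≤k))
    grow : ∀ {c K k} → (∀ {j} → K ≤ j → ⟦ x ⟧ M⁺ (τ j) ≡ c) → K < k →
      ⟦ □ x ⟧ M⁺ (τ (suc K)) ≡ true → ⟦ □ x ⟧ M⁺ (τ k) ≡ true
    grow {K = K} h K<k e = let base , below = □-τ⁻ x e in □-τ⁺ x base λ {j} _ →
      [ below ∘ s≤s , (λ K≤j → trans (trans (h K≤j) (sym (h ≤-refl))) (below ≤-refl)) ]′ (≤-total j K)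

  □-τ⇒w₀ : ∀ {k} C → 0 < k → ⟦ □ C ⟧ M⁺ (τ k) ≡ true → ⟦ C ⟧ M w₀ ≡ true
  □-τ⇒w₀ C 0<k e = trans (sym (⟦⟧-τ₀ C)) (proj₂ (□-τ⁻ C e) 0<k)

  ⟦⟧-τ-Rf : ∀ Y → ⟦ ⋀Rf Y ⟧ M w₀ ≡ true → ∀ k → ⟦ Y ⟧ M⁺ (τ k) ≡ ⟦ Y ⟧ M w₀
  ⟦⟧-τ-Rf Y rf = ⟦⟧-τ-reflected Y (⋀Rf-true⁻ Y M w₀ rf)

Closed : (M : Model) → List (W M) → Set
Closed M S = ∀ {u v} → u ∈ S → v ∈ succ M u → v ∈ S

module _ (M : Model) where

  cone : W M → List (W M)
  cone a = a ∷ succ M a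

  cone-closed : ∀ a → Closed M (cone a)
  cone-closed a (here refl) m = there m
  cone-closed a (there m₁) m₂ = there (succ-trans M m₁ m₂)

  □-cone : ∀ {a u} C → ⟦ □ C ⟧ M a ≡ true → u ∈ cone a → ⟦ □ C ⟧ M u ≡ true
  □-cone C e (here refl) = e
  □-cone C e (there m) = □-persist M C e m

  ++-closed : ∀ {S S'} → Closed M S → Closed M S' → Closed M (S ++ S')
  ++-closed {S} c c' m = [ (λ m₁ → ∈-++⁺ˡ ∘ c m₁) , (λ m₂ → ∈-++⁺ʳ S ∘ c' m₂) ]′ (∈-++⁻ S m)

  height : List (W M) → ℕ
  height = foldr (λ u n → rank M u ⊔ n) 0

  rank≤height : ∀ {u} xs → u ∈ xs → rank M u ≤ height xs
  rank≤height (x ∷ xs) (here refl) = m≤m⊔n (rank M x) (height xs)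
  rank≤height (x ∷ xs) (there m) = ≤-trans (rank≤height xs m) (m≤n⊔m (rank M x) (height xs))

module Root (M : Model) (S : List (W M)) (S-closed : Closed M S) where

  succ⁺ : W M ⊎ ⊤ → List (W M ⊎ ⊤)
  succ⁺ (inj₁ w) = map inj₁ (succ M w)
  succ⁺ (inj₂ _) = map inj₁ S

  succ⁺-trans : ∀ {w u v} → u ∈ succ⁺ w → v ∈ succ⁺ u → v ∈ succ⁺ w
  succ⁺-trans {inj₁ w} m₁ m₂ with ∈-map⁻ inj₁ m₁
  ... | _ , ma , refl with ∈-map⁻ inj₁ m₂
  ...   | _ , mb , refl = ∈-map⁺ inj₁ (succ-trans M ma mb)
  succ⁺-trans {inj₂ _} m₁ m₂ with ∈-map⁻ inj₁ m₁
  ... | _ , ma , refl with ∈-map⁻ inj₁ m₂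
  ...   | _ , mb , refl = ∈-map⁺ inj₁ (S-closed ma mb)

  rank⁺ : W M ⊎ ⊤ → ℕ
  rank⁺ (inj₁ w) = rank M w
  rank⁺ (inj₂ _) = suc (height M S)

  rank⁺-succ : ∀ {w u} → u ∈ succ⁺ w → rank⁺ u < rank⁺ w
  rank⁺-succ {inj₁ w} m with ∈-map⁻ inj₁ m
  ... | _ , mu , refl = rank-succ M mu
  rank⁺-succ {inj₂ _} m with ∈-map⁻ inj₁ m
  ... | _ , mu , refl = s≤s (rank≤height M S mu)

  M⁺ : Model
  M⁺ = record
    { W = W M ⊎ ⊤
    ; succ = succ⁺
    ; V = [ V M , (λ _ _ → false) ]′
    ; rank = rank⁺
    ; succ-trans = λ {w} → succ⁺-trans {w}
    ; rank-succ = λ {w} → rank⁺-succ {w}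
    }

  ι : Embedding M M⁺
  ι = record { embed = inj₁ ; embed-succ = λ w → refl ; embed-V = λ w → refl }

  root : W M⁺
  root = inj₂ tt

  ⟦□⟧-root : ∀ C → ⟦ □ C ⟧ M⁺ root ≡ all (⟦ C ⟧ M) S
  ⟦□⟧-root C = trans (all-map (⟦ C ⟧ M⁺) inj₁ S) (all-cong S (λ {u} _ → ⟦⟧-embed ι u C))

-- Soundness of the extensions of GL

module _ {ℓ} {Γ : Fm → Set} (Holds : ℕ → Fm → Set ℓ)
  (holds-mp : ∀ {k X Y} → Holds k (X ⇒ Y) → Holds k X → Holds k Y)
  (holds-GL : ∀ {X} → GL⊢ X → ∀ k → Holds k X)
  (holds-Γ : ∀ {A} σ → Γ A → Eventually (λ k → Holds k (subst σ A)))
  where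

  eventually-sound : ∀ {B} → Γ ⊢ B → ∀ σ → Eventually (λ k → Holds k (subst σ B))
  eventually-sound (gl d) σ = 0 , λ {k} _ → holds-GL (usub σ d) k
  eventually-sound (hyp h) σ = holds-Γ σ h
  eventually-sound (mp d e) σ =
    let K , h = eventually-× (eventually-sound d σ) (eventually-sound e σ)
    in K , λ le → let h₁ , h₂ = h le in holds-mp h₁ h₂
  eventually-sound (usub {B} τ d) σ =
    let K , h = eventually-sound d (subst σ ∘ τ)
    in K , λ {k} le → ≡-subst (Holds k) (sym (subst-∘ σ τ B)) (h le)

GLS-sound : ∀ {B} → GLS ⊢ B → ∀ M w₀ → Eventually (λ k → ⟦ B ⟧ (Tail.M⁺ M w₀) (Tail.τ M w₀ k) ≡ true)
GLS-sound {B} d M w₀ = let K , h = eventually-sound Holds not∨-elim (λ d k → sound d M⁺ (τ k)) reflection d var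
                      in K , λ le → trans (sym (⟦subst-var⟧ M⁺ (τ _) B)) (h le)
  where
  open Tail M w₀
  Holds : ℕ → Fm → Set
  Holds k X = ⟦ X ⟧ M⁺ (τ k) ≡ true
  -- σ 0 is constant from τ K on, and □ σ 0 at τ k > K forces σ 0 at τ K.
  reflection : ∀ {A} σ → GLS A → Eventually (λ k → Holds k (subst σ A))
  reflection σ refl = let c , K , h = τ-stable (σ 0) in suc K , λ {k} K<k → not∨-intro λ e →
    trans (h (≤-trans (n≤1+n K) K<k)) (trans (sym (h ≤-refl)) (proj₂ (□-τ⁻ (σ 0) e) K<k))

GLω-sound : ∀ {B} → GLω ⊢ B →
  Eventually (λ n → ∀ M w → ⟦ ◇^ n ⊤' ⟧ M w ≡ true → ⟦ B ⟧ M w ≡ true)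
GLω-sound {B} d =
  let K , h = eventually-sound Holds (λ {_} {X} h₁ h₂ M w e → not∨-elim {⟦ X ⟧ M w} (h₁ M w e) (h₂ M w e))
                               (λ d _ M w _ → sound d M w) diamonds d var
  in K , λ le M w e → trans (sym (⟦subst-var⟧ M w B)) (h le M w e)
  where
  Holds : ℕ → Fm → Set₁
  Holds n X = ∀ M w → ⟦ ◇^ n ⊤' ⟧ M w ≡ true → ⟦ X ⟧ M w ≡ true
  diamonds : ∀ {A} σ → GLω A → Eventually (λ k → Holds k (subst σ A))
  diamonds σ (n , refl) = n , λ {k} n≤k M w e →
    ≡-subst (λ Y → ⟦ ¬' Y ⟧ M w ≡ true) (sym (subst-□^ σ n (¬' ⊤'))) (◇^⊤-antitone M w n≤k e)

GL¬F-sound : ∀ {s B} → GL¬F s ⊢ B → ∀ M w → ⟦ ¬' (F s) ⟧ M w ≡ true → ⟦ B ⟧ M w ≡ true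
GL¬F-sound {s} {B} d M w e = let _ , h = eventually-sound Holds not∨-elim (λ d _ → sound d M w) axiom d var
                             in trans (sym (⟦subst-var⟧ M w B)) (h ≤-refl)
  where
  Holds : ℕ → Fm → Set
  Holds _ X = ⟦ X ⟧ M w ≡ true
  axiom : ∀ {A} σ → GL¬F s A → Eventually (λ k → Holds k (subst σ A))
  axiom σ refl = 0 , λ _ → ≡-subst (λ Y → ⟦ Y ⟧ M w ≡ true)
    (sym (cong₂ (λ a b → ¬' (a ⇒ b)) (subst-□^ σ (suc s) ⊥') (subst-□^ σ s ⊥'))) e

GLS⊢□⇒ : ∀ X → GLS ⊢ (□ X ⇒ X)
GLS⊢□⇒ X = usub (nth (X ∷ [])) (hyp refl)

GLS⊢◇^⊤ : ∀ n → GLS ⊢ ◇^ n ⊤'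
GLS⊢◇^⊤ zero = gl (tautology (¬' (¬' ⊤')) [])
GLS⊢◇^⊤ (suc n) = mp (mp (gl (tautology ((q ⇒ p) ⇒ ¬' p ⇒ ¬' q) (Y ∷ □ Y ∷ []))) (GLS⊢□⇒ Y)) (GLS⊢◇^⊤ n)
  where
  Y : Fm
  Y = □^ n (¬' ⊤')

GLω⊆GLS : ∀ {B} → GLω ⊢ B → GLS ⊢ B
GLω⊆GLS (gl d) = gl d
GLω⊆GLS (hyp (n , refl)) = GLS⊢◇^⊤ n
GLω⊆GLS (mp d e) = mp (GLω⊆GLS d) (GLω⊆GLS e)
GLω⊆GLS (usub σ d) = usub σ (GLω⊆GLS d)

-- Deep worlds

module _ (M : Model) (L : List Fm) where

  □-count : W M → ℕ
  □-count w = countᵇ (λ C → ⟦ □ C ⟧ M w) L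

  -- Pigeonhole: □-count is at most length L, so it cannot increase at each of the k steps below x.
  □-count-plateau : (P : W M → Set) → (∀ {u v} → P u → v ∈ succ M u → P v) →
    ∀ k x → P x → ⟦ □^ k ⊥' ⟧ M x ≡ false → length L < k + □-count x →
    Σ (W M) λ x' → Σ (W M) λ y → P x' × Σ (y ∈ succ M x') λ m → □-count x' ≡ □-count y
  □-count-plateau P P-succ zero x px _ long = ⊥-elim (<⇒≱ long (countᵇ≤length _ L))
  □-count-plateau P P-succ (suc k) x px deep long with □-false M (□^ k ⊥') deep
  ... | x₁ , m , deep₁ with □-count x ≟ □-count x₁
  ...   | yes eq = x , x₁ , px , m , eq
  ...   | no neq = □-count-plateau P P-succ k x₁ (P-succ px m) deep₁ (≤-trans long (begin
    suc k + □-count x  ≡⟨ sym (+-suc k (□-count x)) ⟩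
    k + suc (□-count x) ≤⟨ +-monoʳ-≤ k (≤∧≢⇒< (countᵇ-mono _ _ L λ {C} _ e → □-persist M C e m) neq) ⟩
    k + □-count x₁      ∎))
    where open ≤-Reasoning

Rf-world : ∀ A s M x → cx A < s → ⟦ □^ s ⊥' ⟧ M x ≡ false → ⟦ □ A ⟧ M x ≡ true →
  Σ (W M) λ y → ⟦ ⋀Rf (□ A) ⟧ M y ≡ true × ⟦ □ A ⟧ M y ≡ true
Rf-world A s M x cx<s deep □A with □-count-plateau M (distinctBoxedArgs A) (λ w → ⟦ □ A ⟧ M w ≡ true)
                                     (□-persist M A) s x □A deep (≤-trans cx<s (m≤m+n s _))
... | x' , y , □A' , m , eq = y , ⋀Rf-true⁺ (□ A) M y reflected , □-persist M A □A' m
  where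
  reflected : ∀ {C} → C ∈ boxedArgs (□ A) → ⟦ □ C ⇒ C ⟧ M y ≡ true
  reflected (here refl) = not∨-intro λ _ → □-elim M A □A' m
  reflected {C} (there mC) = not∨-intro λ e →
    □-elim M C (countᵇ-≡ _ _ (distinctBoxedArgs A) (λ {D} _ e′ → □-persist M D e′ m) eq (∈-dedup⁺ _ mC) e) m

rising-edge : ∀ (f : ℕ → Bool) → f 0 ≡ false → ∀ c → f c ≡ true → Σ ℕ λ j → j < c × f j ≡ false × f (suc j) ≡ true
rising-edge f f0 zero fc = ⊥-elim (not-¬ fc f0)
rising-edge f f0 (suc c) fc with f c in e
... | false = c , ≤-refl , e , fc
... | true = let j , j<c , fj , fj+1 = rising-edge f f0 c e in j , m≤n⇒m≤1+n j<c , fj , fj+1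

exact-depth-world : ∀ s M w c → c ≤ suc s → ⟦ □^ c ⊥' ⟧ M w ≡ true →
  Σ ℕ λ m → ⟦ ¬' (F s) ⟧ (Tail.M⁺ M w) (Tail.τ M w m) ≡ true × (c ≤ s → 0 < m)
exact-depth-world s M w c c≤1+s □^c with rising-edge (λ j → ⟦ □^ j ⊥' ⟧ M w) refl c □^c
... | j , j<c , □^j , □^1+j = s ∸ j , ¬F , λ c≤s → m<n⇒0<n∸m (<-≤-trans j<c c≤s)
  where
  open Tail M w
  j+m≡s : j + (s ∸ j) ≡ s
  j+m≡s = m+[n∸m]≡n (≤-pred (≤-trans j<c c≤1+s))
  ¬F : ⟦ ¬' (F s) ⟧ M⁺ (τ (s ∸ j)) ≡ true
  ¬F = cong not (not∨-false⁺
    (≡-subst (λ n → ⟦ □^ (suc n) ⊥' ⟧ M⁺ (τ (s ∸ j)) ≡ true) j+m≡s (trans (τ-□^⊥ (s ∸ j) (suc j)) □^1+j))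
    (≡-subst (λ n → ⟦ □^ n ⊥' ⟧ M⁺ (τ (s ∸ j)) ≡ false) j+m≡s (trans (τ-□^⊥ (s ∸ j) j) □^j)))

module _ (A : Fm) (M : Model) (w₀ y : W M) where

  join-countermodel : ∀ n → ⟦ □ A ⟧ M w₀ ≡ true → ⟦ A ⟧ M w₀ ≡ false →
    ⟦ ⋀Rf (□ A) ⟧ M y ≡ true → ⟦ □ A ⟧ M y ≡ true →
    Σ Model λ Z → Σ (W Z) λ z → ⟦ ◇^ (suc n) ⊤' ⟧ Z z ≡ true × ⟦ □ (□ A) ⟧ Z z ≡ true × ⟦ □ A ⟧ Z z ≡ false
  join-countermodel n □A₀ ¬A₀ rf □Ay = M⁺ , root , deep , □□A , ¬□A
    where
    open Tail M y using (τ; τ-□^⊥-false; ⟦⟧-τ-Rf) renaming (M⁺ to Mᵗ; ι to ιᵗ)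
    S : List (W Mᵗ)
    S = cone Mᵗ (τ n) ++ cone Mᵗ (inj₁ w₀)
    open Root Mᵗ S (++-closed Mᵗ (cone-closed Mᵗ (τ n)) (cone-closed Mᵗ (inj₁ w₀)))
    τ∈S : τ n ∈ S
    τ∈S = ∈-++⁺ˡ {xs = cone Mᵗ (τ n)} (here refl)
    w₀∈S : inj₁ w₀ ∈ S
    w₀∈S = ∈-++⁺ʳ (cone Mᵗ (τ n)) (here refl)
    deep : ⟦ ◇^ (suc n) ⊤' ⟧ M⁺ root ≡ true
    deep = ¬□^⊥⇒◇^⊤ M⁺ (suc n) root (□-refuted M⁺ {root} (□^ n ⊥') (∈-map⁺ inj₁ τ∈S)
      (trans (⟦⟧-embed ι (τ n) (□^ n ⊥')) (τ-□^⊥-false n)))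
    □A-on-S : ∀ {u} → u ∈ S → ⟦ □ A ⟧ Mᵗ u ≡ true
    □A-on-S m = [ □-cone Mᵗ A (trans (⟦⟧-τ-Rf (□ A) rf n) □Ay) , □-cone Mᵗ A (trans (⟦⟧-embed ιᵗ w₀ (□ A)) □A₀) ]′
      (∈-++⁻ (cone Mᵗ (τ n)) m)
    □□A : ⟦ □ (□ A) ⟧ M⁺ root ≡ true
    □□A = trans (⟦□⟧-root (□ A)) (all-true⁺ S □A-on-S)
    ¬□A : ⟦ □ A ⟧ M⁺ root ≡ false
    ¬□A = trans (⟦□⟧-root A) (all-false⁺ S w₀∈S (trans (⟦⟧-embed ιᵗ w₀ A) ¬A₀))

-- The five conditions

Undecided : (Fm → Set) → Fm → Set
Undecided Γ B = ¬ (Γ ⊢ B) × ¬ (Γ ⊢ ¬' B)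

Nontrifling : Fm → Set
Nontrifling A = ¬ (GLω ⊢ (□ (□ A) ⇒ □ A))

RfCriterion : Fm → Set
RfCriterion A = ¬ (GL⊢ A) × ¬ (GL⊢ (⋀Rf (□ A) ⇒ ¬' (□ A)))

nontrifling⇒undecided-GLω : ∀ A → Nontrifling A → Undecided GLω (□ A)
nontrifling⇒undecided-GLω A nontrifling =
  (λ d → nontrifling (mp (gl (tautology (q ⇒ p ⇒ q) (□ (□ A) ∷ □ A ∷ []))) d)) , ⊬¬□A
  where
  ⊬¬□A : ¬ (GLω ⊢ ¬' (□ A))
  ⊬¬□A d with GLω-sound d
  ... | n , ¬□A-sound = countermodel X ⊬X λ (M , w , refuted) → impossible M w refuted
    where
    X : Fm
    X = ◇^ (suc n) ⊤' ⇒ □ (□ A) ⇒ □ A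
    ⊬X : ¬ GL⊢ X
    ⊬X e = nontrifling (mp (gl e) (hyp (suc n , refl)))
    impossible : ∀ M w → ⟦ X ⟧ M w ≡ false → ⊥
    impossible M w refuted =
      let ◇ , rest = not∨-false⁻ refuted ; □□A , _ = not∨-false⁻ rest
          u , m , shallow = □-false M (□^ n ⊥') (◇^⊤⇒¬□^⊥ M (suc n) w ◇)
      in not-¬ (□-elim M (□ A) □□A m) (not-true (¬□A-sound ≤-refl M u (¬□^⊥⇒◇^⊤ M n u shallow)))

deep⇒¬□ : ∀ A s → cx A < s → GL⊢ (⋀Rf (□ A) ⇒ ¬' (□ A)) →
  ∀ M w → ⟦ □^ s ⊥' ⟧ M w ≡ false → ⟦ □ A ⟧ M w ≡ false
deep⇒¬□ A s cx<s d M w deep = ¬-not λ □A →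
  let y , rf , □Ay = Rf-world A s M w cx<s deep □A in not-¬ □Ay (not-true (not∨-elim (sound d M y) rf))

undecided⇒RfCriterion : ∀ {Γ} A s P → cx A < s → Γ P → (∀ M w → ⟦ P ⟧ M w ≡ true → ⟦ □^ s ⊥' ⟧ M w ≡ false) →
  Undecided Γ (□ A) → RfCriterion A
undecided⇒RfCriterion A s P cx<s axiom P-deep (⊬□A , ⊬¬□A) = ⊬□A ∘ gl ∘ nec , λ d →
  countermodel (P ⇒ ¬' (□ A)) (λ e → ⊬¬□A (mp (gl e) (hyp axiom))) λ (M , w , refuted) →
    let P-true , ¬¬□A = not∨-false⁻ refuted in not-¬ (not-false ¬¬□A) (deep⇒¬□ A s cx<s d M w (P-deep M w P-true))

undecided-GLω⇒RfCriterion : ∀ A s → cx A < s → Undecided GLω (□ A) → RfCriterion A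
undecided-GLω⇒RfCriterion A s cx<s = undecided⇒RfCriterion A s (◇^ s ⊤') cx<s (s , refl) (λ M → ◇^⊤⇒¬□^⊥ M s)

undecided-GL¬F⇒RfCriterion : ∀ A s → cx A < s → Undecided (GL¬F s) (□ A) → RfCriterion A
undecided-GL¬F⇒RfCriterion A s cx<s =
  undecided⇒RfCriterion A s (¬' (F s)) cx<s refl (λ M w e → proj₂ (not∨-false⁻ (not-true e)))

undecided-GLS⇒undecided-GLω : ∀ A → Undecided GLS (□ A) → Undecided GLω (□ A)
undecided-GLS⇒undecided-GLω A (⊬□A , ⊬¬□A) = ⊬□A ∘ GLω⊆GLS , ⊬¬□A ∘ GLω⊆GLS

RfCriterion⇒undecided-GLS : ∀ A → RfCriterion A → Undecided GLS (□ A)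
RfCriterion⇒undecided-GLS A (⊬A , ⊬Rf⇒¬□A) = ⊬□A , ⊬¬□A
  where
  ⊬□A : ¬ (GLS ⊢ □ A)
  ⊬□A d = countermodel A ⊬A λ (M , w , ¬A) →
    let K , □A-eventually = GLS-sound d M w in not-¬ (Tail.□-τ⇒w₀ M w A (s≤s z≤n) (□A-eventually (n≤1+n K))) ¬A
  ⊬¬□A : ¬ (GLS ⊢ ¬' (□ A))
  ⊬¬□A d = countermodel (⋀Rf (□ A) ⇒ ¬' (□ A)) ⊬Rf⇒¬□A λ (M , y , refuted) →
    let rf , ¬¬□A = not∨-false⁻ refuted ; K , ¬□A-eventually = GLS-sound d M y
    in not-¬ (trans (Tail.⟦⟧-τ-Rf M y (□ A) rf K) (not-false ¬¬□A)) (not-true (¬□A-eventually ≤-refl))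

RfCriterion⇒undecided-GL¬F : ∀ A s → cx A < s → RfCriterion A → Undecided (GL¬F s) (□ A)
RfCriterion⇒undecided-GL¬F A s cx<s (⊬A , ⊬Rf⇒¬□A) = ⊬□A , ⊬¬□A
  where
  ⊬□A : ¬ (GL¬F s ⊢ □ A)
  ⊬□A d = completeness A (distinctBoxedArgs A) (∈-dedup⁺ _) (∈-dedup⁻ _) λ (M , rank≤ , refutes) →
    refutes (sub-refl A) ⊬A λ (w , ¬A) →
      let shallow = ≤-trans (s≤s (rank≤ w)) cx<s
          m , ¬F , positive = exact-depth-world s M w _ (m≤n⇒m≤1+n shallow) (rank<⇒□^⊥ M _ w ≤-refl)
      in not-¬ (Tail.□-τ⇒w₀ M w A (positive shallow) (GL¬F-sound d _ _ ¬F)) ¬A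
  ⊬¬□A : ¬ (GL¬F s ⊢ ¬' (□ A))
  ⊬¬□A d = completeness X (A ∷ distinctBoxedArgs A) (□-args⊆ A ∘ boxedArgs-Rf⇒¬□ A)
                         (∈-++⁺ʳ (boxedArgs (⋀Rf (□ A))) ∘ □-args⊇ A) λ (M , rank≤ , refutes) →
    refutes (sub-refl X) ⊬Rf⇒¬□A λ (y , refuted) →
      let rf , ¬¬□A = not∨-false⁻ refuted
          m , ¬F , _ = exact-depth-world s M y _ (s≤s (≤-trans (rank≤ y) cx<s)) (rank<⇒□^⊥ M _ y ≤-refl)
      in not-¬ (trans (Tail.⟦⟧-τ-Rf M y (□ A) rf m) (not-false ¬¬□A)) (not-true (GL¬F-sound d _ _ ¬F))
    where
    X : Fm
    X = ⋀Rf (□ A) ⇒ ¬' (□ A)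

RfCriterion⇒nontrifling : ∀ A → RfCriterion A → Nontrifling A
RfCriterion⇒nontrifling A (⊬A , ⊬Rf⇒¬□A) d with GLω-sound d
... | n , □□A⇒□A-sound = completeness X (boxedArgs X) id id λ (M , _ , refutes) →
  refutes (there (∈-++⁺ˡ (sub-refl (□ A ⇒ A)))) (⊬A ∘ löb-rule) λ (w₀ , w₀-refuted) →
  refutes (there (∈-++⁺ʳ (sub (□ A ⇒ A)) (sub-refl _))) ⊬Rf⇒¬□A λ (y , y-refuted) →
    let □A₀ , ¬A₀ = not∨-false⁻ w₀-refuted ; rf , ¬¬□Ay = not∨-false⁻ y-refuted
        Z , z , ◇ , □□A , ¬□A = join-countermodel A M w₀ y n □A₀ ¬A₀ rf (not-false ¬¬□Ay)
    in not-¬ (not∨-elim (□□A⇒□A-sound (n≤1+n n) Z z ◇) □□A) ¬□A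
  where
  X : Fm
  X = (□ A ⇒ A) ⋏ (⋀Rf (□ A) ⇒ ¬' (□ A))

proposition3p11 : (A : Fm) (s : ℕ) → cx A < s →
  ((¬ (GLω ⊢ (□ (□ A) ⇒ □ A)))
    ⇔ (¬ (GLω ⊢ □ A) × ¬ (GLω ⊢ ¬' (□ A))))
  × ((¬ (GLω ⊢ □ A) × ¬ (GLω ⊢ ¬' (□ A)))
    ⇔ (¬ (GLS ⊢ □ A) × ¬ (GLS ⊢ ¬' (□ A))))
  × ((¬ (GLS ⊢ □ A) × ¬ (GLS ⊢ ¬' (□ A)))
    ⇔ (¬ (GL¬F s ⊢ □ A) × ¬ (GL¬F s ⊢ ¬' (□ A))))
  × ((¬ (GL¬F s ⊢ □ A) × ¬ (GL¬F s ⊢ ¬' (□ A)))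
    ⇔ (¬ (GL⊢ A) × ¬ (GL⊢ (⋀Rf (□ A) ⇒ ¬' (□ A)))))
proposition3p11 A s cx<s =
  mk⇔ (nontrifling⇒undecided-GLω A) (RfCriterion⇒nontrifling A ∘ GLω⇒Rf) ,
  mk⇔ (RfCriterion⇒undecided-GLS A ∘ GLω⇒Rf) (undecided-GLS⇒undecided-GLω A) ,
  mk⇔ (RfCriterion⇒undecided-GL¬F A s cx<s ∘ GLω⇒Rf ∘ undecided-GLS⇒undecided-GLω A)
      (RfCriterion⇒undecided-GLS A ∘ GL¬F⇒Rf) ,
  mk⇔ GL¬F⇒Rf (RfCriterion⇒undecided-GL¬F A s cx<s)
  where
  GLω⇒Rf : Undecided GLω (□ A) → RfCriterion A
  GLω⇒Rf = undecided-GLω⇒RfCriterion A s cx<s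
  GL¬F⇒Rf : Undecided (GL¬F s) (□ A) → RfCriterion A
  GL¬F⇒Rf = undecided-GL¬F⇒RfCriterion A s cx<s
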